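{- For all positive integers $d$ and $m$, \[ E^+_{d^m} = \sum_{\tau} \operatorname{sgn}(\tau)\, \kappa_\tau\, E_{m\tau} \qquad\text{and}\qquad H^+_{d^m} = \sum_{\tau} \operatorname{sgn}(\tau)\, \kappa_\tau\, H_{m\tau}, \] where both sums are over all stack partitions $\tau$ of $d$ in which every stack has multiplicity $1$ or $2$ and at most one stack has multiplicity $2$.
   Context: $\mathsf{P\Lambda}$ denotes the $\mathbb{Q}$-algebra of polysymmetric functions: formal power series of bounded degree in variables $x_{i,j}$ ($i,j\ge1$), $x_{i,j}$ of degree $i$, invariant under every permutation of $x_{i,1},x_{i,2},\dots$ for each fixed $i$. A stack is a pair of positive integers $d^m$ (degree $d$, multiplicity $m$); a stack partition $\tau\Vdash n$ is a finite weakly decreasing sequence of stacks $(d_1^{m_1},\dots,d_s^{m_s})$ (with $d^m\ge d'^{m'}$ iff $d>d'$, or $d=d'$ and $m\ge m'$) with $\sum d_im_i=n$; an ordinary partition $\alpha\vdash n$ has all multiplicities $1$; $\ell(\tau)=s$, $\operatorname{area}(\tau)=\sum m_i$, $\operatorname{sgn}(\tau)=(-1)^{\operatorname{area}(\tau)}$. $M_\tau=\sum_\alpha x_{d_1,\alpha_1}^{m_1}\cdots x_{d_s,\alpha_s}^{m_s}$ over sequences $\alpha$ of positive integers with $\alpha_i\ne\alpha_j$ whenever $d_i=d_j$, $i\ne j$. Define $H_d=\sum_{\alpha\Vdash d}M_\alpha$, $E^+_d=\sum_{\alpha\vdash d}M_\alpha$, $E_d=\sum_{\alpha\vdash d}(-1)^{\ell(\alpha)}M_\alpha$,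 $H^+_d=\sum_{\alpha\Vdash d}(-1)^{\operatorname{area}(\alpha)}M_\alpha$. For each such $F$, $F_{d^m}$ is $F_d$ with each $x_{i,j}$ replaced by $x_{i,j}^m$, and for a stack partition $\tau=(d_1^{m_1},\dots,d_s^{m_s})$, $F_\tau=\prod_i F_{d_i^{m_i}}$. For a positive integer $m$, $m\tau$ denotes the stack partition obtained from $\tau$ by multiplying every multiplicity by $m$. Let $m_{i,j}(\tau)$ be the number of occurrences of the stack $i^j$ in $\tau$, $N_j(\tau)=\sum_i m_{i,j}(\tau)$, and $\kappa_\tau=\prod_j\binom{N_j(\tau)}{m_{1,j}(\tau),\,m_{2,j}(\tau),\,\dots}$ (multinomial coefficients, product over $j$ with $N_j(\tau)>0$). -}

module Defs where

open import Data.Nat using (ℕ; zero; suc; _≤_; _<_; _≟_; _≤ᵇ_; _≡ᵇ_; _%_; _/_)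
import Data.Nat as N
open import Data.Nat.Combinatorics using (_C_)
open import Data.Integer using (ℤ; +_; -_)
import Data.Integer as Z
open import Data.Bool using (Bool; true; false; if_then_else_; _∧_)
open import Data.Product using (_×_; _,_; proj₁; proj₂)
open import Data.Sum using (_⊎_)
open import Data.List using (List; []; _∷_; map; filter; length; upTo; concatMap; deduplicate; foldr)
import Data.List.Properties as LP
import Data.Product.Properties as PP
open import Data.List.Relation.Unary.All using (All)
open import Data.List.Relation.Unary.AllPairs using (AllPairs)
open import Data.List.Relation.Unary.Linked using (Linked)
open import Relation.Nullary.Decidable using (does)
open import Relation.Binary.PropositionalEquality using (_≡_)

-- A monomial is a list of entries (i , j , e) meaning x_{i,j}^e.
-- A monomial is *valid* (canonical) if i ≥ 1, j ≥ 1, e ≥ 1 for every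
-- entry and the entries are strictly increasing in the
-- lexicographic order on (i , j) (so every variable occurs at most once).

Entry : Set
Entry = ℕ × ℕ × ℕ

Mono : Set
Mono = List Entry

_<ᵥ_ : Entry → Entry → Set
(i , j , _) <ᵥ (i' , j' , _) = i < i' ⊎ (i ≡ i' × j < j')

ValidMono : Mono → Set
ValidMono μ =
  All (λ { (i , j , e) → 1 ≤ i × 1 ≤ j × 1 ≤ e }) μ × AllPairs _<ᵥ_ μ

-- A (formal power series) element of the ambient ring, given by its
-- coefficient on each valid monomial.  Two series are equal iff their
-- coefficients agree on every valid monomial.
Series : Set
Series = Mono → ℤ

_≐_ : Series → Series → Set
F ≐ G = ∀ μ → ValidMono μ → F μ ≡ G μ

-- Stacks and stack partitions.  A stack d^m is the pair (d , m).

Stack : Set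
Stack = ℕ × ℕ

SP : Set
SP = List Stack

_≥ₛ_ : Stack → Stack → Set
(d , m) ≥ₛ (d' , m') = d' < d ⊎ (d ≡ d' × m' ≤ m)

weight : SP → ℕ
weight τ = foldr (λ s acc → proj₁ s N.* proj₂ s N.+ acc) 0 τ

area : SP → ℕ
area τ = foldr (λ s acc → proj₂ s N.+ acc) 0 τ

IsStackPartitionOf : ℕ → SP → Set
IsStackPartitionOf n τ =
  All (λ s → 1 ≤ proj₁ s × 1 ≤ proj₂ s) τ × Linked _≥ₛ_ τ × weight τ ≡ n

sgnℤ : ℕ → ℤ
sgnℤ zero = + 1
sgnℤ (suc k) = - sgnℤ k

-- The type of a monomial: the stack partition (sorted weakly decreasingly)
-- of its (degree , exponent) pairs.

geᵇ : Stack → Stack → Bool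
geᵇ (d , m) (d' , m') = if d ≡ᵇ d' then m' ≤ᵇ m else d' ≤ᵇ d

insertS : Stack → SP → SP
insertS s [] = s ∷ []
insertS s (t ∷ ts) = if geᵇ s t then s ∷ t ∷ ts else t ∷ insertS s ts

sortS : SP → SP
sortS = foldr insertS []

monoType : Mono → SP
monoType μ = sortS (map (λ { (i , j , e) → (i , e) }) μ)

_≟SP_ : (σ τ : SP) → Bool
σ ≟SP τ = does (LP.≡-dec (PP.≡-dec _≟_ _≟_) σ τ)

-- Monomial polysymmetric function M_τ: the sum of the distinct monomials
-- of type τ.
M : SP → Series
M τ μ = if monoType μ ≟SP τ then + 1 else + 0

-- Σ_{α ⊩ n, P α} c(α) M_α, written coefficientwise: on a valid monomial μ
-- exactly one M_α is nonzero, namely α = type(μ), with coefficient 1.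
sumM : ℕ → (SP → Bool) → (SP → ℤ) → Series
sumM n P c μ =
  let t = monoType μ in
  if (weight t ≡ᵇ n) ∧ P t then c t else + 0

allᵇ : {A : Set} → (A → Bool) → List A → Bool
allᵇ p = foldr (λ x b → p x ∧ b) true

allOnes : SP → Bool
allOnes = allᵇ (λ s → proj₂ s ≡ᵇ 1)

Hd : ℕ → Series
Hd d = sumM d (λ _ → true) (λ _ → + 1)

E⁺d : ℕ → Series
E⁺d d = sumM d allOnes (λ _ → + 1)

Ed : ℕ → Series
Ed d = sumM d allOnes (λ α → sgnℤ (length α))

H⁺d : ℕ → Series
H⁺d d = sumM d (λ _ → true) (λ α → sgnℤ (area α))

zeroS : Series
zeroS _ = + 0

oneS : Series
oneS [] = + 1
oneS (_ ∷ _) = + 0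

_⊕_ : Series → Series → Series
(F ⊕ G) μ = F μ Z.+ G μ

_·_ : ℤ → Series → Series
(c · F) μ = c Z.* F μ

consNZ : Entry → Mono → Mono
consNZ (i , j , zero) μ = μ
consNZ (i , j , suc e) μ = (i , j , suc e) ∷ μ

splits : Mono → List (Mono × Mono)
splits [] = ([] , []) ∷ []
splits ((i , j , e) ∷ μ) =
  concatMap (λ a → map (λ p → consNZ (i , j , a) (proj₁ p) , consNZ (i , j , e N.∸ a) (proj₂ p)) (splits μ))
            (upTo (suc e))

sumℤ : List ℤ → ℤ
sumℤ = foldr Z._+_ (+ 0)

_⊛_ : Series → Series → Series
(F ⊛ G) μ = sumℤ (map (λ p → F (proj₁ p) Z.* G (proj₂ p)) (splits μ))

prodS : List Series → Series
prodS = foldr _⊛_ oneS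

sumS : List Series → Series
sumS = foldr _⊕_ zeroS

-- F ↦ F with every x_{i,j} replaced by x_{i,j}^m  (m ≥ 1; the value for
-- m = 0 is irrelevant and set to 0).
powSub : ℕ → Series → Series
powSub zero F μ = + 0
powSub (suc k) F μ =
  if allᵇ (λ { (i , j , e) → e % suc k ≡ᵇ 0 }) μ
  then F (map (λ { (i , j , e) → (i , j , e / suc k) }) μ)
  else + 0

stackF : (ℕ → Series) → Stack → Series
stackF F (d , m) = powSub m (F d)

partF : (ℕ → Series) → SP → Series
partF F τ = prodS (map (stackF F) τ)

scaleSP : ℕ → SP → SP
scaleSP m = map (λ s → (proj₁ s , m N.* proj₂ s))

countℕ : ℕ → List ℕ → ℕ
countℕ x xs = length (filter (_≟ x) xs)

-- multinomial(k₁+…+k_r; k₁,…,k_r) = Π_i C(k_i + … + k_r, k_i)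
multinomial : List ℕ → ℕ
multinomial [] = 1
multinomial (k ∷ ks) = ((k N.+ foldr N._+_ 0 ks) C k) N.* multinomial ks

degsWith : ℕ → SP → List ℕ
degsWith j τ = map proj₁ (filter (λ s → proj₂ s ≟ j) τ)

countsWith : ℕ → SP → List ℕ
countsWith j τ = map (λ i → countℕ i (degsWith j τ)) (deduplicate _≟_ (degsWith j τ))

κ : SP → ℕ
κ τ = foldr N._*_ 1
        (map (λ j → multinomial (countsWith j τ)) (deduplicate _≟_ (map proj₂ τ)))

OneTwo : SP → Set
OneTwo τ =
  All (λ s → proj₂ s ≡ 1 ⊎ proj₂ s ≡ 2) τ × length (filter (λ s → proj₂ s ≟ 2) τ) ≤ 1

rhsSum : (ℕ → Series) → ℕ → List SP → Series
rhsSum F m L = sumS (map (λ τ → (sgnℤ (area τ) Z.* + κ τ) · partF F (scaleSP m τ)) L)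

-- After the substitution x ↦ xᵐ, E_k, H_k, E⁺_k and H⁺_k become the weight-mk parts of the
-- products over all variables of 1 − xᵐ, 1/(1 − xᵐ), 1 + xᵐ and 1/(1 + xᵐ).  As
-- 1 + tᵐ = (1 − t²ᵐ)/(1 − tᵐ) and 1/(1 + tᵐ) = (1 − tᵐ)/(1 − t²ᵐ), in both cases the target
-- product is B·C, where B inverts the product A whose weight-mk parts are the F_{k^m}, and the
-- weight-2mk parts of C are the F_{k^{2m}}.  Up to weight md, A agrees with 1 + Y for
-- Y = Σ_{k≤d} F_{k^m}, whose powers beyond the d-th vanish there, so B agrees with the
-- alternating sum Σ_{ℓ≤d} (−1)^ℓ Y^ℓ; and C agrees with 1 + Z for Z = Σ_{k≤d} F_{k^{2m}}.
-- Expanding Y^ℓ and Z·Y^ℓ degree by degree with the binomial theorem produces each stack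
-- partition τ with ℓ stacks of multiplicity 1 and at most one of multiplicity 2 exactly once,
-- with coefficient κ_τ, and sgn(τ) = (−1)^ℓ.

module Submission where

open import Defs
open import Level using (0ℓ)
open import Algebra.Bundles using (CommutativeRing; CommutativeMonoid)
import Algebra.Properties.CommutativeSemigroup as CommutativeSemigroupProperties
open import Data.Bool using (Bool; true; false; if_then_else_; _∧_; T)
open import Data.Bool.Properties using (if-∧; if-eta; ∧-conicalˡ; ∧-conicalʳ; ∧-commutativeMonoid)
open import Data.Empty using (⊥-elim)
open import Data.Unit using (tt)
open import Data.Fin using (toℕ)
open import Data.Integer using (ℤ; +_; -_; _+_; _*_; _-_; -1ℤ)
open import Data.Integer.Properties hiding (_≟_)
import Data.Integer.Tactic.RingSolver as ℤ-Solver
open import Data.List using (List; []; _∷_; map; length; foldr; filter; replicate; _++_; concatMap; applyUpTo; upTo; deduplicate)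
import Data.List.Properties as Listₚ
open import Data.List.Membership.Propositional using (_∈_; _∉_; find; lose)
open import Data.List.Membership.Propositional.Properties
open import Data.List.Membership.Propositional.Properties.WithK using (unique∧set⇒bag)
open import Data.List.Relation.Binary.BagAndSetEquality using (∼bag⇒↭)
open import Data.List.Relation.Binary.Permutation.Propositional using (↭⇒↭ₛ)
import Data.List.Relation.Binary.Permutation.Propositional.Properties as ↭ₚ
open import Data.List.Relation.Binary.Permutation.Setoid.Properties using (foldr-commMonoid)
open import Data.List.Relation.Unary.All as All using (All; []; _∷_)
import Data.List.Relation.Unary.All.Properties as Allₚ
open import Data.List.Relation.Unary.Any using (here; there)
open import Data.List.Relation.Unary.AllPairs using ([]; _∷_)
open import Data.List.Relation.Unary.Linked as Linked using (Linked; []; [-]; _∷_)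
open import Data.List.Relation.Unary.Linked.Properties using (Linked⇒All)
open import Data.List.Relation.Unary.Unique.Propositional using (Unique)
import Data.List.Relation.Unary.Unique.Propositional.Properties as Uniqueₚ
open import Data.Nat as ℕ using (ℕ; zero; suc; _∸_; _≤_; _<_; s≤s; z≤n; _≟_; _≡ᵇ_; _%_; _/_)
import Data.Nat.Properties as ℕₚ
open import Data.List.Relation.Unary.Unique.DecPropositional.Properties _≟_ using (deduplicate-!)
import Data.Nat.Tactic.RingSolver as ℕ-Solver
open import Data.Nat.Combinatorics using (_C_)
open import Data.Nat.DivMod using (m≡m%n+[m/n]*n; m<n⇒m%n≡m; [m+n]%n≡m%n; m/n≡1+[m∸n]/n; m/n≡0⇒m<n)
open import Data.Nat.Divisibility using (_∣_; divides; _∣?_; _∣0; ∣m∣n⇒∣m+n; ∣n⇒∣m*n; ∣-refl; m%n≡0⇒n∣m)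
open import Data.Nat.Induction using (<-rec)
import Data.Product.Properties as Productₚ
open import Data.Product using (_×_; _,_; proj₁; proj₂)
open import Data.Sum using (_⊎_; inj₁; inj₂; [_,_]′)
open import Function using (_∘_; id)
open import Function.Bundles using (_⇔_; mk⇔)
import Function.Properties.Equivalence as ⇔
open import Relation.Binary.Bundles using (Setoid)
open import Relation.Binary.PropositionalEquality
open import Relation.Binary.Structures using (IsEquivalence)
import Relation.Binary.Reasoning.Setoid as SetoidReasoning
open import Relation.Nullary using (¬_; Dec; yes; no; does; ¬?)
open import Relation.Nullary.Decidable using (dec-true; dec-false)

-- Finite sums of integers

private
  module ℤ+ = CommutativeSemigroupProperties +-commutativeSemigroup
  module ℤ* = CommutativeSemigroupProperties *-commutativeSemigroup
  module ℕ+ = CommutativeSemigroupProperties ℕₚ.+-commutativeSemigroup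

sumBelow : ℕ → (ℕ → ℤ) → ℤ
sumBelow zero    f = + 0
sumBelow (suc n) f = f 0 + sumBelow n (f ∘ suc)

sumAntidiagonal : ℕ → (ℕ → ℕ → ℤ) → ℤ
sumAntidiagonal zero    h = h 0 0
sumAntidiagonal (suc e) h = h 0 (suc e) + sumAntidiagonal e (λ b c → h (suc b) c)

sumBelow-cong : ∀ n {f g : ℕ → ℤ} → (∀ a → f a ≡ g a) → sumBelow n f ≡ sumBelow n g
sumBelow-cong zero    eq = refl
sumBelow-cong (suc n) eq = cong₂ _+_ (eq 0) (sumBelow-cong n (eq ∘ suc))

sumBelow-zero : ∀ n → sumBelow n (λ _ → + 0) ≡ + 0
sumBelow-zero zero    = refl
sumBelow-zero (suc n) = trans (+-identityˡ _) (sumBelow-zero n)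

sumBelow-last : ∀ n (f : ℕ → ℤ) → sumBelow (suc n) f ≡ sumBelow n f + f n
sumBelow-last zero    f = +-comm (f 0) (+ 0)
sumBelow-last (suc n) f =
  trans (cong (_+_ (f 0)) (sumBelow-last n (f ∘ suc))) (sym (+-assoc (f 0) _ (f (suc n))))

sumBelow-antidiagonal : ∀ e (h : ℕ → ℕ → ℤ) → sumBelow (suc e) (λ a → h a (e ∸ a)) ≡ sumAntidiagonal e h
sumBelow-antidiagonal zero    h = +-identityʳ _
sumBelow-antidiagonal (suc e) h = cong (_+_ (h 0 (suc e))) (sumBelow-antidiagonal e (λ b c → h (suc b) c))

sumAntidiagonal-cong : ∀ e {h h′ : ℕ → ℕ → ℤ} → (∀ b c → h b c ≡ h′ b c) →
                       sumAntidiagonal e h ≡ sumAntidiagonal e h′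
sumAntidiagonal-cong zero    eq = eq 0 0
sumAntidiagonal-cong (suc e) eq = cong₂ _+_ (eq 0 (suc e)) (sumAntidiagonal-cong e (λ b c → eq (suc b) c))

sumAntidiagonal-+ : ∀ e (h h′ : ℕ → ℕ → ℤ) →
                    sumAntidiagonal e (λ b c → h b c + h′ b c) ≡ sumAntidiagonal e h + sumAntidiagonal e h′
sumAntidiagonal-+ zero    h h′ = refl
sumAntidiagonal-+ (suc e) h h′ =
  trans (cong (_+_ (h 0 (suc e) + h′ 0 (suc e))) (sumAntidiagonal-+ e _ _))
        (ℤ+.interchange (h 0 (suc e)) (h′ 0 (suc e)) _ _)

sumAntidiagonal-*ˡ : ∀ e x (h : ℕ → ℕ → ℤ) → sumAntidiagonal e (λ b c → x * h b c) ≡ x * sumAntidiagonal e h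
sumAntidiagonal-*ˡ zero    x h = refl
sumAntidiagonal-*ˡ (suc e) x h =
  trans (cong (_+_ (x * h 0 (suc e))) (sumAntidiagonal-*ˡ e x _)) (sym (*-distribˡ-+ x (h 0 (suc e)) _))

sumAntidiagonal-zero : ∀ e → sumAntidiagonal e (λ _ _ → + 0) ≡ + 0
sumAntidiagonal-zero zero    = refl
sumAntidiagonal-zero (suc e) = trans (+-identityˡ _) (sumAntidiagonal-zero e)

sumAntidiagonal-last : ∀ e (h : ℕ → ℕ → ℤ) →
                       sumAntidiagonal (suc e) h ≡ sumAntidiagonal e (λ b c → h b (suc c)) + h (suc e) 0
sumAntidiagonal-last zero    h = refl
sumAntidiagonal-last (suc e) h =
  trans (cong (_+_ (h 0 (suc (suc e)))) (sumAntidiagonal-last e (λ b c → h (suc b) c)))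
        (sym (+-assoc (h 0 (suc (suc e))) _ (h (suc (suc e)) 0)))

sumAntidiagonal-comm : ∀ e (h : ℕ → ℕ → ℤ) → sumAntidiagonal e h ≡ sumAntidiagonal e (λ b c → h c b)
sumAntidiagonal-comm zero    h = refl
sumAntidiagonal-comm (suc e) h = begin
  h 0 (suc e) + sumAntidiagonal e (λ b c → h (suc b) c)
    ≡⟨ cong (_+_ (h 0 (suc e))) (sumAntidiagonal-comm e (λ b c → h (suc b) c)) ⟩
  h 0 (suc e) + sumAntidiagonal e (λ b c → h (suc c) b)
    ≡⟨ +-comm (h 0 (suc e)) _ ⟩
  sumAntidiagonal e (λ b c → h (suc c) b) + h 0 (suc e)
    ≡⟨ sumAntidiagonal-last e (λ b c → h c b) ⟨
  sumAntidiagonal (suc e) (λ b c → h c b)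
    ∎
  where open ≡-Reasoning

sumAntidiagonal-assoc : ∀ e (h : ℕ → ℕ → ℕ → ℤ) →
  sumAntidiagonal e (λ a c → sumAntidiagonal a (λ b b′ → h b b′ c)) ≡
  sumAntidiagonal e (λ b a → sumAntidiagonal a (λ b′ c → h b b′ c))
sumAntidiagonal-assoc zero    h = refl
sumAntidiagonal-assoc (suc e) h = begin
  h 0 0 (suc e) + sumAntidiagonal e (λ a c → h 0 (suc a) c + sumAntidiagonal a (λ b b′ → h (suc b) b′ c))
    ≡⟨ cong (_+_ (h 0 0 (suc e))) (sumAntidiagonal-+ e _ _) ⟩
  h 0 0 (suc e) + (sumAntidiagonal e (λ a c → h 0 (suc a) c) +
                   sumAntidiagonal e (λ a c → sumAntidiagonal a (λ b b′ → h (suc b) b′ c)))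
    ≡⟨ cong (λ z → h 0 0 (suc e) + (sumAntidiagonal e (λ a c → h 0 (suc a) c) + z)) (sumAntidiagonal-assoc e (h ∘ suc)) ⟩
  h 0 0 (suc e) + (sumAntidiagonal e (λ a c → h 0 (suc a) c) +
                   sumAntidiagonal e (λ b a → sumAntidiagonal a (λ b′ c → h (suc b) b′ c)))
    ≡⟨ +-assoc (h 0 0 (suc e)) _ _ ⟨
  sumAntidiagonal (suc e) (h 0) + sumAntidiagonal e (λ b a → sumAntidiagonal a (λ b′ c → h (suc b) b′ c))
    ∎
  where open ≡-Reasoning

private
  variable
    A B : Set

sumℤ-++ : ∀ (f : A → ℤ) xs ys → sumℤ (map f (xs ++ ys)) ≡ sumℤ (map f xs) + sumℤ (map f ys)
sumℤ-++ f []       ys = sym (+-identityˡ _)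
sumℤ-++ f (x ∷ xs) ys = trans (cong (_+_ (f x)) (sumℤ-++ f xs ys)) (sym (+-assoc (f x) _ _))

sumℤ-cong : ∀ {f g : A → ℤ} xs → All (λ x → f x ≡ g x) xs → sumℤ (map f xs) ≡ sumℤ (map g xs)
sumℤ-cong []       []         = refl
sumℤ-cong (x ∷ xs) (eq ∷ eqs) = cong₂ _+_ eq (sumℤ-cong xs eqs)

sumℤ-cong′ : ∀ {f g : A → ℤ} xs → (∀ x → f x ≡ g x) → sumℤ (map f xs) ≡ sumℤ (map g xs)
sumℤ-cong′ xs eq = sumℤ-cong xs (All.universal eq xs)

sumℤ-+ : ∀ (f g : A → ℤ) xs → sumℤ (map (λ x → f x + g x) xs) ≡ sumℤ (map f xs) + sumℤ (map g xs)
sumℤ-+ f g []       = refl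
sumℤ-+ f g (x ∷ xs) = trans (cong (_+_ (f x + g x)) (sumℤ-+ f g xs)) (ℤ+.interchange (f x) (g x) _ _)

sumℤ-*ˡ : ∀ c (f : A → ℤ) xs → sumℤ (map (λ x → c * f x) xs) ≡ c * sumℤ (map f xs)
sumℤ-*ˡ c f []       = sym (*-zeroʳ c)
sumℤ-*ˡ c f (x ∷ xs) = trans (cong (_+_ (c * f x)) (sumℤ-*ˡ c f xs)) (sym (*-distribˡ-+ c (f x) _))

sumℤ-zero : ∀ {f : A → ℤ} xs → All (λ x → f x ≡ + 0) xs → sumℤ (map f xs) ≡ + 0
sumℤ-zero []       []         = refl
sumℤ-zero (x ∷ xs) (eq ∷ eqs) = cong₂ _+_ eq (sumℤ-zero xs eqs)

sumℤ-map : ∀ (f : B → ℤ) (g : A → B) xs → sumℤ (map f (map g xs)) ≡ sumℤ (map (f ∘ g) xs)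
sumℤ-map f g xs = cong sumℤ (sym (Listₚ.map-∘ xs))

sumℤ-concatMap : ∀ (f : B → ℤ) (g : A → List B) xs →
                 sumℤ (map f (concatMap g xs)) ≡ sumℤ (map (λ x → sumℤ (map f (g x))) xs)
sumℤ-concatMap f g []       = refl
sumℤ-concatMap f g (x ∷ xs) =
  trans (sumℤ-++ f (g x) (concatMap g xs)) (cong (_+_ (sumℤ (map f (g x)))) (sumℤ-concatMap f g xs))

sumℤ-sumAntidiagonal : ∀ e (h : A → ℕ → ℕ → ℤ) xs →
  sumℤ (map (λ x → sumAntidiagonal e (h x)) xs) ≡ sumAntidiagonal e (λ b c → sumℤ (map (λ x → h x b c) xs))
sumℤ-sumAntidiagonal e h []       = sym (sumAntidiagonal-zero e)
sumℤ-sumAntidiagonal e h (x ∷ xs) =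
  trans (cong (_+_ (sumAntidiagonal e (h x))) (sumℤ-sumAntidiagonal e h xs)) (sym (sumAntidiagonal-+ e (h x) _))

sumℤ-filter : ∀ {P : A → Set} (P? : ∀ x → Dec (P x)) (f : A → ℤ) xs →
              sumℤ (map f (filter P? xs)) ≡ sumℤ (map (λ x → if does (P? x) then f x else + 0) xs)
sumℤ-filter P? f []       = refl
sumℤ-filter P? f (x ∷ xs) with does (P? x)
... | true  = cong (_+_ (f x)) (sumℤ-filter P? f xs)
... | false = trans (sumℤ-filter P? f xs) (sym (+-identityˡ _))

sumℤ-same-elements : ∀ (f : A → ℤ) {xs ys} → Unique xs → Unique ys → (∀ {x} → x ∈ xs ⇔ x ∈ ys) →
                     sumℤ (map f xs) ≡ sumℤ (map f ys)
sumℤ-same-elements f uxs uys same =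
  foldr-commMonoid ℤ+-monoid.setoid ℤ+-monoid.isCommutativeMonoid
    (↭⇒↭ₛ (↭ₚ.map⁺ f (∼bag⇒↭ (unique∧set⇒bag uxs uys same))))
  where module ℤ+-monoid = CommutativeMonoid +-0-commutativeMonoid

sumℤ-applyUpTo : ∀ (f : ℕ → ℤ) n → sumℤ (applyUpTo f n) ≡ sumBelow n f
sumℤ-applyUpTo f zero    = refl
sumℤ-applyUpTo f (suc n) = cong (_+_ (f 0)) (sumℤ-applyUpTo (f ∘ suc) n)

sumℤ-upTo : ∀ (f : ℕ → ℤ) n → sumℤ (map f (upTo n)) ≡ sumBelow n f
sumℤ-upTo f n = trans (cong sumℤ (Listₚ.map-upTo f n)) (sumℤ-applyUpTo f n)

-- The ring of series

-- Series are compared only on monomials with positive degrees and exponents: these include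
-- every valid monomial, and on them oneS is a unit for ⊛.
exponent : Entry → ℕ
exponent x = proj₂ (proj₂ x)

Positive : Mono → Set
Positive = All (λ x → 1 ≤ proj₁ x × 1 ≤ exponent x)

infix 4 _≈_
_≈_ : Series → Series → Set
F ≈ G = ∀ μ → Positive μ → F μ ≡ G μ

weightMono : Mono → ℕ
weightMono = foldr (λ x w → proj₁ x ℕ.* exponent x ℕ.+ w) 0

-- (F ↾ (i , j , a)) μ is the coefficient of F at x_{i,j}^a · μ.
_↾_ : Series → Entry → Series
(F ↾ x) μ = F (consNZ x μ)

⊛-cons : ∀ (F G : Series) i j e ν →
  (F ⊛ G) ((i , j , e) ∷ ν) ≡ sumAntidiagonal e (λ b c → ((F ↾ (i , j , b)) ⊛ (G ↾ (i , j , c))) ν)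
⊛-cons F G i j e ν = begin
  sumℤ (map term (concatMap splitsWith (upTo (suc e))))
    ≡⟨ sumℤ-concatMap term splitsWith (upTo (suc e)) ⟩
  sumℤ (map (λ a → sumℤ (map term (splitsWith a))) (upTo (suc e)))
    ≡⟨ sumℤ-cong′ (upTo (suc e)) (λ a → sumℤ-map term (consBoth a) (splits ν)) ⟩
  sumℤ (map (λ a → h a (e ∸ a)) (upTo (suc e)))
    ≡⟨ sumℤ-upTo (λ a → h a (e ∸ a)) (suc e) ⟩
  sumBelow (suc e) (λ a → h a (e ∸ a))
    ≡⟨ sumBelow-antidiagonal e h ⟩
  sumAntidiagonal e h
    ∎
  where
  open ≡-Reasoning
  term : Mono × Mono → ℤ
  term (μ₁ , μ₂) = F μ₁ * G μ₂
  consBoth : ℕ → Mono × Mono → Mono × Mono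
  consBoth a (μ₁ , μ₂) = consNZ (i , j , a) μ₁ , consNZ (i , j , e ∸ a) μ₂
  splitsWith : ℕ → List (Mono × Mono)
  splitsWith a = map (consBoth a) (splits ν)
  h : ℕ → ℕ → ℤ
  h b c = ((F ↾ (i , j , b)) ⊛ (G ↾ (i , j , c))) ν

⊛-consNZ : ∀ (F G : Series) i j e ν →
  (F ⊛ G) (consNZ (i , j , e) ν) ≡ sumAntidiagonal e (λ b c → ((F ↾ (i , j , b)) ⊛ (G ↾ (i , j , c))) ν)
⊛-consNZ F G i j zero    ν = refl
⊛-consNZ F G i j (suc e) ν = ⊛-cons F G i j (suc e) ν

⊛-congˡ : ∀ {F F′} G → F ≗ F′ → F ⊛ G ≗ F′ ⊛ G
⊛-congˡ G eq μ = sumℤ-cong′ (splits μ) (λ p → cong (_* G (proj₂ p)) (eq (proj₁ p)))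

⊛-congʳ : ∀ F {G G′} → G ≗ G′ → F ⊛ G ≗ F ⊛ G′
⊛-congʳ F eq μ = sumℤ-cong′ (splits μ) (λ p → cong (F (proj₁ p) *_) (eq (proj₂ p)))

⊛-sumAntidiagonalˡ : ∀ a (H : ℕ → ℕ → Series) K →
  (λ μ → sumAntidiagonal a (λ b c → H b c μ)) ⊛ K ≗ λ μ → sumAntidiagonal a (λ b c → (H b c ⊛ K) μ)
⊛-sumAntidiagonalˡ a H K μ =
  trans (sumℤ-cong′ (splits μ) (λ p → trans (*-comm (sumAntidiagonal a (λ b c → H b c (proj₁ p))) _)
          (trans (sym (sumAntidiagonal-*ˡ a (K (proj₂ p)) _))
                 (sumAntidiagonal-cong a (λ b c → *-comm (K (proj₂ p)) (H b c (proj₁ p)))))))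
        (sumℤ-sumAntidiagonal a (λ p b c → H b c (proj₁ p) * K (proj₂ p)) (splits μ))

⊛-sumAntidiagonalʳ : ∀ a (H : ℕ → ℕ → Series) K →
  K ⊛ (λ μ → sumAntidiagonal a (λ b c → H b c μ)) ≗ λ μ → sumAntidiagonal a (λ b c → (K ⊛ H b c) μ)
⊛-sumAntidiagonalʳ a H K μ =
  trans (sumℤ-cong′ (splits μ) (λ p → sym (sumAntidiagonal-*ˡ a (K (proj₁ p)) _)))
        (sumℤ-sumAntidiagonal a (λ p b c → K (proj₁ p) * H b c (proj₂ p)) (splits μ))

⊛-comm : ∀ F G → F ⊛ G ≗ G ⊛ F
⊛-comm F G []                = cong (_+ + 0) (*-comm (F []) (G []))
⊛-comm F G ((i , j , e) ∷ ν) = begin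
  (F ⊛ G) ((i , j , e) ∷ ν)
    ≡⟨ ⊛-cons F G i j e ν ⟩
  sumAntidiagonal e (λ b c → ((F ↾ (i , j , b)) ⊛ (G ↾ (i , j , c))) ν)
    ≡⟨ sumAntidiagonal-cong e (λ b c → ⊛-comm (F ↾ (i , j , b)) (G ↾ (i , j , c)) ν) ⟩
  sumAntidiagonal e (λ b c → ((G ↾ (i , j , c)) ⊛ (F ↾ (i , j , b))) ν)
    ≡⟨ sumAntidiagonal-comm e (λ b c → ((G ↾ (i , j , b)) ⊛ (F ↾ (i , j , c))) ν) ⟨
  sumAntidiagonal e (λ b c → ((G ↾ (i , j , b)) ⊛ (F ↾ (i , j , c))) ν)
    ≡⟨ ⊛-cons G F i j e ν ⟨
  (G ⊛ F) ((i , j , e) ∷ ν)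
    ∎
  where open ≡-Reasoning

⊛-assoc : ∀ F G K → (F ⊛ G) ⊛ K ≗ F ⊛ (G ⊛ K)
⊛-assoc F G K [] =
  cong (_+ + 0) (trans (cong (_* K []) (+-identityʳ (F [] * G [])))
                (trans (*-assoc (F []) (G []) (K [])) (cong (F [] *_) (sym (+-identityʳ (G [] * K []))))))
⊛-assoc F G K ((i , j , e) ∷ ν) = begin
  ((F ⊛ G) ⊛ K) ((i , j , e) ∷ ν)
    ≡⟨ ⊛-cons (F ⊛ G) K i j e ν ⟩
  sumAntidiagonal e (λ a c → (((F ⊛ G) ↾ (i , j , a)) ⊛ K′ c) ν)
    ≡⟨ sumAntidiagonal-cong e (λ a c → ⊛-congˡ (K′ c) (⊛-consNZ F G i j a) ν) ⟩
  sumAntidiagonal e (λ a c → ((λ q → sumAntidiagonal a (λ b b′ → (F′ b ⊛ G′ b′) q)) ⊛ K′ c) ν)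
    ≡⟨ sumAntidiagonal-cong e (λ a c → ⊛-sumAntidiagonalˡ a (λ b b′ → F′ b ⊛ G′ b′) (K′ c) ν) ⟩
  sumAntidiagonal e (λ a c → sumAntidiagonal a (λ b b′ → ((F′ b ⊛ G′ b′) ⊛ K′ c) ν))
    ≡⟨ sumAntidiagonal-cong e (λ a c → sumAntidiagonal-cong a (λ b b′ → ⊛-assoc (F′ b) (G′ b′) (K′ c) ν)) ⟩
  sumAntidiagonal e (λ a c → sumAntidiagonal a (λ b b′ → (F′ b ⊛ (G′ b′ ⊛ K′ c)) ν))
    ≡⟨ sumAntidiagonal-assoc e (λ b b′ c → (F′ b ⊛ (G′ b′ ⊛ K′ c)) ν) ⟩
  sumAntidiagonal e (λ b a → sumAntidiagonal a (λ b′ c → (F′ b ⊛ (G′ b′ ⊛ K′ c)) ν))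
    ≡⟨ sumAntidiagonal-cong e (λ b a → ⊛-sumAntidiagonalʳ a (λ b′ c → G′ b′ ⊛ K′ c) (F′ b) ν) ⟨
  sumAntidiagonal e (λ b a → (F′ b ⊛ (λ q → sumAntidiagonal a (λ b′ c → (G′ b′ ⊛ K′ c) q))) ν)
    ≡⟨ sumAntidiagonal-cong e (λ b a → ⊛-congʳ (F′ b) (⊛-consNZ G K i j a) ν) ⟨
  sumAntidiagonal e (λ b a → (F′ b ⊛ ((G ⊛ K) ↾ (i , j , a))) ν)
    ≡⟨ ⊛-cons F (G ⊛ K) i j e ν ⟨
  (F ⊛ (G ⊛ K)) ((i , j , e) ∷ ν)
    ∎
  where
  open ≡-Reasoning
  F′ G′ K′ : ℕ → Series
  F′ b = F ↾ (i , j , b)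
  G′ b = G ↾ (i , j , b)
  K′ b = K ↾ (i , j , b)

⊛-distribˡ-⊕ : ∀ F G K → F ⊛ (G ⊕ K) ≗ (F ⊛ G) ⊕ (F ⊛ K)
⊛-distribˡ-⊕ F G K μ =
  trans (sumℤ-cong′ (splits μ) (λ p → *-distribˡ-+ (F (proj₁ p)) (G (proj₂ p)) (K (proj₂ p))))
        (sumℤ-+ (λ p → F (proj₁ p) * G (proj₂ p)) (λ p → F (proj₁ p) * K (proj₂ p)) (splits μ))

⊛-·ʳ : ∀ c F G → F ⊛ (c · G) ≗ c · (F ⊛ G)
⊛-·ʳ c F G μ =
  trans (sumℤ-cong′ (splits μ) (λ p → ℤ*.x∙yz≈y∙xz (F (proj₁ p)) c (G (proj₂ p))))
        (sumℤ-*ˡ c (λ p → F (proj₁ p) * G (proj₂ p)) (splits μ))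

⊛-·ˡ : ∀ c F G → (c · F) ⊛ G ≗ c · (F ⊛ G)
⊛-·ˡ c F G μ = trans (⊛-comm (c · F) G μ) (trans (⊛-·ʳ c G F μ) (cong (c *_) (⊛-comm G F μ)))

⊛-zeroˡ : ∀ {F} G → F ≗ zeroS → F ⊛ G ≗ zeroS
⊛-zeroˡ G eq μ =
  sumℤ-zero (splits μ) (All.universal (λ p → cong (_* G (proj₂ p)) (eq (proj₁ p))) (splits μ))

⊛-identityˡ : ∀ F → oneS ⊛ F ≈ F
⊛-identityˡ F []                      _                 = trans (+-identityʳ (+ 1 * F [])) (*-identityˡ (F []))
⊛-identityˡ F ((i , j , suc e) ∷ ν) ((_ , s≤s _) ∷ pν) = begin
  (oneS ⊛ F) ((i , j , suc e) ∷ ν)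
    ≡⟨ ⊛-cons oneS F i j (suc e) ν ⟩
  (oneS ⊛ (F ↾ (i , j , suc e))) ν + sumAntidiagonal e (λ b c → ((oneS ↾ (i , j , suc b)) ⊛ (F ↾ (i , j , c))) ν)
    ≡⟨ cong₂ _+_ (⊛-identityˡ (F ↾ (i , j , suc e)) ν pν)
                 (trans (sumAntidiagonal-cong e (λ b c → ⊛-zeroˡ (F ↾ (i , j , c)) (λ _ → refl) ν))
                        (sumAntidiagonal-zero e)) ⟩
  F ((i , j , suc e) ∷ ν) + + 0
    ≡⟨ +-identityʳ _ ⟩
  F ((i , j , suc e) ∷ ν)
    ∎
  where open ≡-Reasoning

consNZ-positive : ∀ {i} j a {μ} → 1 ≤ i → Positive μ → Positive (consNZ (i , j , a) μ)
consNZ-positive j zero    _  pμ = pμ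
consNZ-positive j (suc a) hi pμ = (hi , s≤s z≤n) ∷ pμ

consNZ-weight : ∀ i j a μ → weightMono (consNZ (i , j , a) μ) ≡ i ℕ.* a ℕ.+ weightMono μ
consNZ-weight i j zero    μ = cong (ℕ._+ weightMono μ) (sym (ℕₚ.*-zeroʳ i))
consNZ-weight i j (suc a) μ = refl

splits-All : ∀ (Q : Mono → Mono × Mono → Set) → Q [] ([] , []) →
  (∀ i j e ν a μ₁ μ₂ → a ≤ e → Q ν (μ₁ , μ₂) →
     Q ((i , j , e) ∷ ν) (consNZ (i , j , a) μ₁ , consNZ (i , j , e ∸ a) μ₂)) →
  ∀ μ → All (Q μ) (splits μ)
splits-All Q q[] q∷ []                = q[] ∷ []
splits-All Q q[] q∷ ((i , j , e) ∷ ν) =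
  Allₚ.concat⁺ (Allₚ.map⁺ (Allₚ.applyUpTo⁺₁ id (suc e) (λ {a} a<1+e →
    Allₚ.map⁺ (All.map (λ {p} → q∷ i j e ν a (proj₁ p) (proj₂ p) (ℕₚ.≤-pred a<1+e)) (splits-All Q q[] q∷ ν)))))

SplitsWell : Mono → Mono × Mono → Set
SplitsWell μ (μ₁ , μ₂) =
  (Positive μ → Positive μ₁ × Positive μ₂) × weightMono μ₁ ℕ.+ weightMono μ₂ ≡ weightMono μ

splits-well : ∀ μ → All (SplitsWell μ) (splits μ)
splits-well = splits-All SplitsWell ((λ _ → [] , []) , refl) step
  where
  step : ∀ i j e ν a μ₁ μ₂ → a ≤ e → SplitsWell ν (μ₁ , μ₂) →
         SplitsWell ((i , j , e) ∷ ν) (consNZ (i , j , a) μ₁ , consNZ (i , j , e ∸ a) μ₂)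
  step i j e ν a μ₁ μ₂ a≤e (pos , wt) =
    (λ { ((hi , _) ∷ pν) → consNZ-positive j a hi (proj₁ (pos pν)) , consNZ-positive j (e ∸ a) hi (proj₂ (pos pν)) }) ,
    (begin
      weightMono (consNZ (i , j , a) μ₁) ℕ.+ weightMono (consNZ (i , j , e ∸ a) μ₂)
        ≡⟨ cong₂ ℕ._+_ (consNZ-weight i j a μ₁) (consNZ-weight i j (e ∸ a) μ₂) ⟩
      (i ℕ.* a ℕ.+ weightMono μ₁) ℕ.+ (i ℕ.* (e ∸ a) ℕ.+ weightMono μ₂)
        ≡⟨ ℕ+.interchange (i ℕ.* a) (weightMono μ₁) (i ℕ.* (e ∸ a)) (weightMono μ₂) ⟩
      (i ℕ.* a ℕ.+ i ℕ.* (e ∸ a)) ℕ.+ (weightMono μ₁ ℕ.+ weightMono μ₂)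
        ≡⟨ cong₂ ℕ._+_ (trans (sym (ℕₚ.*-distribˡ-+ i a (e ∸ a))) (cong (i ℕ.*_) (ℕₚ.m+[n∸m]≡n a≤e))) wt ⟩
      i ℕ.* e ℕ.+ weightMono ν
        ∎)
    where
    open ≡-Reasoning

⊛-cong : ∀ {F F′ G G′} → F ≈ F′ → G ≈ G′ → F ⊛ G ≈ F′ ⊛ G′
⊛-cong {F} {F′} {G} {G′} eqF eqG μ pμ = sumℤ-cong (splits μ) (All.map factors (splits-well μ))
  where
  factors : ∀ {p} → SplitsWell μ p → F (proj₁ p) * G (proj₂ p) ≡ F′ (proj₁ p) * G′ (proj₂ p)
  factors {μ₁ , μ₂} (pos , _) = cong₂ _*_ (eqF μ₁ (proj₁ (pos pμ))) (eqG μ₂ (proj₂ (pos pμ)))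

negS : Series → Series
negS F μ = - F μ

≈-isEquivalence : IsEquivalence _≈_
≈-isEquivalence = record
  { refl  = λ _ _ → refl
  ; sym   = λ eq μ pμ → sym (eq μ pμ)
  ; trans = λ eq eq′ μ pμ → trans (eq μ pμ) (eq′ μ pμ)
  }

seriesRing : CommutativeRing 0ℓ 0ℓ
seriesRing = record
  { Carrier = Series ; _≈_ = _≈_ ; _+_ = _⊕_ ; _*_ = _⊛_ ; -_ = negS ; 0# = zeroS ; 1# = oneS
  ; isCommutativeRing = record
    { isRing = record
      { +-isAbelianGroup = record
        { isGroup = record
          { isMonoid = record
            { isSemigroup = record
              { isMagma = record
                { isEquivalence = ≈-isEquivalence
                ; ∙-cong = λ eqF eqG μ pμ → cong₂ _+_ (eqF μ pμ) (eqG μ pμ) }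
              ; assoc = λ F G H μ _ → +-assoc (F μ) (G μ) (H μ) }
            ; identity = (λ F μ _ → +-identityˡ (F μ)) , (λ F μ _ → +-identityʳ (F μ)) }
          ; inverse = (λ F μ _ → +-inverseˡ (F μ)) , (λ F μ _ → +-inverseʳ (F μ))
          ; ⁻¹-cong = λ eq μ pμ → cong -_ (eq μ pμ) }
        ; comm = λ F G μ _ → +-comm (F μ) (G μ) }
      ; *-cong = ⊛-cong
      ; *-assoc = λ F G H μ _ → ⊛-assoc F G H μ
      ; *-identity = ⊛-identityˡ , (λ F μ pμ → trans (⊛-comm F oneS μ) (⊛-identityˡ F μ pμ))
      ; distrib = (λ F G H μ _ → ⊛-distribˡ-⊕ F G H μ)
                , (λ F G H μ _ → trans (⊛-comm (G ⊕ H) F μ)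
                                   (trans (⊛-distribˡ-⊕ F G H μ) (cong₂ _+_ (⊛-comm F G μ) (⊛-comm F H μ)))) }
    ; *-comm = λ F G μ _ → ⊛-comm F G μ } }

private
  module R = CommutativeRing seriesRing

module ≈-Reasoning = SetoidReasoning R.setoid

open import Algebra.Properties.Semiring.Exp R.semiring using (_^_)

⊛-sumℤ : ∀ {A : Set} G (L : List A) (k : A → ℤ) (Q : A → Series) →
         G ⊛ (λ ν → sumℤ (map (λ t → k t * Q t ν) L)) ≗ λ μ → sumℤ (map (λ t → k t * (G ⊛ Q t) μ) L)
⊛-sumℤ G []      k Q μ = sumℤ-zero (splits μ) (All.universal (λ p → *-zeroʳ (G (proj₁ p))) (splits μ))
⊛-sumℤ G (t ∷ L) k Q μ =
  trans (⊛-distribˡ-⊕ G (k t · Q t) (λ ν → sumℤ (map (λ t → k t * Q t ν) L)) μ)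
        (cong₂ _+_ (⊛-·ʳ (k t) G (Q t) μ) (⊛-sumℤ G L k Q μ))

⊛-sumBelow : ∀ G n (k : ℕ → ℤ) (Q : ℕ → Series) →
             G ⊛ (λ ν → sumBelow n (λ c → k c * Q c ν)) ≗ λ μ → sumBelow n (λ c → k c * (G ⊛ Q c) μ)
⊛-sumBelow G zero    k Q μ = sumℤ-zero (splits μ) (All.universal (λ p → *-zeroʳ (G (proj₁ p))) (splits μ))
⊛-sumBelow G (suc n) k Q μ =
  trans (⊛-distribˡ-⊕ G (k 0 · Q 0) (λ ν → sumBelow n (λ c → k (suc c) * Q (suc c) ν)) μ)
        (cong₂ _+_ (⊛-·ʳ (k 0) G (Q 0) μ) (⊛-sumBelow G n (k ∘ suc) (Q ∘ suc) μ))

prodS-replicate : ∀ c X → prodS (replicate c X) ≡ X ^ c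
prodS-replicate zero    X = refl
prodS-replicate (suc c) X = cong (X ⊛_) (prodS-replicate c X)

prodS-++ : ∀ Xs Ys → prodS (Xs ++ Ys) ≈ prodS Xs ⊛ prodS Ys
prodS-++ []       Ys = R.sym (⊛-identityˡ (prodS Ys))
prodS-++ (X ∷ Xs) Ys = R.trans (⊛-cong {X} R.refl (prodS-++ Xs Ys)) (R.sym (R.*-assoc X (prodS Xs) (prodS Ys)))

binomial : ∀ X Y ℓ → (X ⊕ Y) ^ ℓ ≈ λ μ → sumBelow (suc ℓ) (λ c → + (ℓ C c) * ((X ^ c) ⊛ (Y ^ (ℓ ∸ c))) μ)
binomial X Y ℓ μ pμ =
  trans (Binomial.theorem ℓ X Y μ pμ)
        (trans (fin-sum (suc ℓ) (λ c → (ℓ C c) Mult.× ((X ^ c) ⊛ (Y ^ (ℓ ∸ c)))))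
               (sumBelow-cong (suc ℓ) (λ c → ×-eval (ℓ C c) ((X ^ c) ⊛ (Y ^ (ℓ ∸ c))))))
  where
  import Algebra.Properties.Semiring.Mult R.semiring as Mult
  import Algebra.Properties.Monoid.Sum R.+-monoid as Sum
  import Algebra.Properties.CommutativeSemiring.Binomial R.commutativeSemiring as Binomial
  ×-eval : ∀ n F → (n Mult.× F) μ ≡ + n * F μ
  ×-eval zero    F = refl
  ×-eval (suc n) F = trans (cong (_+_ (F μ)) (×-eval n F))
                           (sym (trans (*-distribʳ-+ (F μ) (+ 1) (+ n)) (cong (_+ + n * F μ) (*-identityˡ (F μ)))))
  fin-sum : ∀ n (h : ℕ → Series) → Sum.sum {n} (λ k → h (toℕ k)) μ ≡ sumBelow n (λ c → h c μ)
  fin-sum zero    h = refl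
  fin-sum (suc n) h = cong (_+_ (h 0 μ)) (fin-sum n (h ∘ suc))

-- Weight and homogeneous components

if-true : ∀ {A : Set} {b} {x y : A} → b ≡ true → (if b then x else y) ≡ x
if-true refl = refl

if-false : ∀ {A : Set} {b} {x y : A} → b ≡ false → (if b then x else y) ≡ y
if-false refl = refl

component : ℕ → Series → Series
component w F μ = if weightMono μ ≡ᵇ w then F μ else + 0

Homogeneous : ℕ → Series → Set
Homogeneous w F = ∀ μ → Positive μ → weightMono μ ≢ w → F μ ≡ + 0

VanishesBelow : ℕ → Series → Set
VanishesBelow w F = ∀ μ → Positive μ → weightMono μ < w → F μ ≡ + 0

infix 4 _≈[≤_]_
_≈[≤_]_ : Series → ℕ → Series → Set
F ≈[≤ w ] G = ∀ μ → Positive μ → weightMono μ ≤ w → F μ ≡ G μ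

weight≡0⇒[] : ∀ {μ} → Positive μ → weightMono μ ≡ 0 → μ ≡ []
weight≡0⇒[] {[]}                          _                     _  = refl
weight≡0⇒[] {(suc i , j , suc e) ∷ ν} ((s≤s _ , s≤s _) ∷ _) ()

Homogeneous-⊛ : ∀ {u v F G} → Homogeneous u F → Homogeneous v G → Homogeneous (u ℕ.+ v) (F ⊛ G)
Homogeneous-⊛ {u} {v} {F} {G} hF hG μ pμ wμ≢u+v = sumℤ-zero (splits μ) (All.map term (splits-well μ))
  where
  term : ∀ {p} → SplitsWell μ p → F (proj₁ p) * G (proj₂ p) ≡ + 0
  term {μ₁ , μ₂} (pos , wt) with weightMono μ₁ ≟ u
  ... | no  w₁≢u = cong (_* G μ₂) (hF μ₁ (proj₁ (pos pμ)) w₁≢u)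
  ... | yes w₁≡u = trans (cong (F μ₁ *_) (hG μ₂ (proj₂ (pos pμ)) w₂≢v)) (*-zeroʳ (F μ₁))
    where w₂≢v = λ w₂≡v → wμ≢u+v (trans (sym wt) (cong₂ ℕ._+_ w₁≡u w₂≡v))

VanishesBelow-⊛ : ∀ {u v F G} → VanishesBelow u F → VanishesBelow v G → VanishesBelow (u ℕ.+ v) (F ⊛ G)
VanishesBelow-⊛ {u} {v} {F} {G} hF hG μ pμ wμ<u+v = sumℤ-zero (splits μ) (All.map term (splits-well μ))
  where
  term : ∀ {p} → SplitsWell μ p → F (proj₁ p) * G (proj₂ p) ≡ + 0
  term {μ₁ , μ₂} (pos , wt) with weightMono μ₁ ℕ.<? u
  ... | yes w₁<u = cong (_* G μ₂) (hF μ₁ (proj₁ (pos pμ)) w₁<u)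
  ... | no  w₁≮u = trans (cong (F μ₁ *_) (hG μ₂ (proj₂ (pos pμ)) w₂<v)) (*-zeroʳ (F μ₁))
    where
    w₂<v : weightMono μ₂ < v
    w₂<v = ℕₚ.+-cancelˡ-< (weightMono μ₁) _ v
             (ℕₚ.<-≤-trans (subst (_< u ℕ.+ v) (sym wt) wμ<u+v) (ℕₚ.+-monoˡ-≤ v (ℕₚ.≮⇒≥ w₁≮u)))

≈[≤]-refl : ∀ {w F} → F ≈[≤ w ] F
≈[≤]-refl _ _ _ = refl

≈[≤]-sym : ∀ {w F G} → F ≈[≤ w ] G → G ≈[≤ w ] F
≈[≤]-sym eq μ pμ le = sym (eq μ pμ le)

≈[≤]-trans : ∀ {w F G H} → F ≈[≤ w ] G → G ≈[≤ w ] H → F ≈[≤ w ] H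
≈[≤]-trans eq eq′ μ pμ le = trans (eq μ pμ le) (eq′ μ pμ le)

≈⇒≈[≤] : ∀ {w F G} → F ≈ G → F ≈[≤ w ] G
≈⇒≈[≤] eq μ pμ _ = eq μ pμ

≈[≤]-weaken : ∀ {w w′ F G} → w ≤ w′ → F ≈[≤ w′ ] G → F ≈[≤ w ] G
≈[≤]-weaken w≤w′ eq μ pμ le = eq μ pμ (ℕₚ.≤-trans le w≤w′)

≈[≤]-⊛ : ∀ {w F F′ G G′} → F ≈[≤ w ] F′ → G ≈[≤ w ] G′ → F ⊛ G ≈[≤ w ] F′ ⊛ G′
≈[≤]-⊛ {w} {F} {F′} {G} {G′} eqF eqG μ pμ wμ≤w = sumℤ-cong (splits μ) (All.map factors (splits-well μ))
  where
  factors : ∀ {p} → SplitsWell μ p → F (proj₁ p) * G (proj₂ p) ≡ F′ (proj₁ p) * G′ (proj₂ p)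
  factors {μ₁ , μ₂} (pos , wt) =
    cong₂ _*_ (eqF μ₁ (proj₁ (pos pμ)) (ℕₚ.≤-trans (ℕₚ.m≤m+n _ _) w₁+w₂≤w))
              (eqG μ₂ (proj₂ (pos pμ)) (ℕₚ.≤-trans (ℕₚ.m≤n+m _ _) w₁+w₂≤w))
    where w₁+w₂≤w = subst (_≤ w) (sym wt) wμ≤w

≈[≤]-setoid : ℕ → Setoid 0ℓ 0ℓ
≈[≤]-setoid w = record
  { Carrier       = Series
  ; _≈_           = _≈[≤ w ]_
  ; isEquivalence = record { refl = ≈[≤]-refl ; sym = ≈[≤]-sym ; trans = ≈[≤]-trans }
  }

module ≈[≤]-Reasoning (w : ℕ) = SetoidReasoning (≈[≤]-setoid w)

component-cong : ∀ {w F G} → F ≈[≤ w ] G → component w F ≈ component w G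
component-cong {w} eq μ pμ with weightMono μ ≟ w
... | yes wμ≡w = trans (if-true (dec-true (weightMono μ ≟ w) wμ≡w))
                       (trans (eq μ pμ (ℕₚ.≤-reflexive wμ≡w)) (sym (if-true (dec-true (weightMono μ ≟ w) wμ≡w))))
... | no  wμ≢w = trans (if-false (dec-false (weightMono μ ≟ w) wμ≢w)) (sym (if-false (dec-false (weightMono μ ≟ w) wμ≢w)))

component-homogeneous : ∀ {w F} → Homogeneous w F → component w F ≈ F
component-homogeneous {w} hF μ pμ with weightMono μ ≟ w
... | yes wμ≡w = if-true (dec-true (weightMono μ ≟ w) wμ≡w)
... | no  wμ≢w = trans (if-false (dec-false (weightMono μ ≟ w) wμ≢w)) (sym (hF μ pμ wμ≢w))

component-homogeneous-≢ : ∀ {u w F} → Homogeneous u F → u ≢ w → component w F ≈ zeroS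
component-homogeneous-≢ {u} {w} hF u≢w μ pμ with weightMono μ ≟ w
... | yes wμ≡w = trans (if-true (dec-true (weightMono μ ≟ w) wμ≡w))
                       (hF μ pμ (λ wμ≡u → u≢w (trans (sym wμ≡u) wμ≡w)))
... | no  wμ≢w = if-false (dec-false (weightMono μ ≟ w) wμ≢w)

Homogeneous-component : ∀ w F → Homogeneous w (component w F)
Homogeneous-component w F μ pμ wμ≢w = if-false (dec-false (weightMono μ ≟ w) wμ≢w)

Homogeneous-oneS : Homogeneous 0 oneS
Homogeneous-oneS []      _ 0≢0 = ⊥-elim (0≢0 refl)
Homogeneous-oneS (_ ∷ _) _ _   = refl

Homogeneous-cong : ∀ {w F G} → F ≈ G → Homogeneous w F → Homogeneous w G
Homogeneous-cong eq hF μ pμ ne = trans (sym (eq μ pμ)) (hF μ pμ ne)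

component-zero : ∀ F μ w → F μ ≡ + 0 → component w F μ ≡ + 0
component-zero F μ w Fμ≡0 =
  trans (cong (if weightMono μ ≡ᵇ w then_else + 0) Fμ≡0) (if-eta (weightMono μ ≡ᵇ w))

component-sumℤ : ∀ {A : Set} w (L : List A) (k : A → ℤ) (Q : A → Series) μ →
  component w (λ ν → sumℤ (map (λ t → k t * Q t ν) L)) μ ≡ sumℤ (map (λ t → k t * component w (Q t) μ) L)
component-sumℤ w L k Q μ with weightMono μ ≡ᵇ w
... | true  = refl
... | false = sym (sumℤ-zero L (All.universal (λ t → *-zeroʳ (k t)) L))

component-sumBelow : ∀ w n (k : ℕ → ℤ) (Q : ℕ → Series) μ →
  component w (λ ν → sumBelow n (λ c → k c * Q c ν)) μ ≡ sumBelow n (λ c → k c * component w (Q c) μ)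
component-sumBelow w n k Q μ with weightMono μ ≡ᵇ w
... | true  = refl
... | false = sym (trans (sumBelow-cong n (λ c → *-zeroʳ (k c))) (sumBelow-zero n))

component-⊕ : ∀ w F G → component w (F ⊕ G) ≗ component w F ⊕ component w G
component-⊕ w F G μ with weightMono μ ≡ᵇ w
... | true  = refl
... | false = refl

VanishesBelow-cong : ∀ {w F G} → F ≈ G → VanishesBelow w F → VanishesBelow w G
VanishesBelow-cong F≈G van μ pμ lt = trans (sym (F≈G μ pμ)) (van μ pμ lt)

VanishesBelow-^ : ∀ {u Y} → VanishesBelow u Y → ∀ n → VanishesBelow (n ℕ.* u) (Y ^ n)
VanishesBelow-^ van zero    μ pμ ()
VanishesBelow-^ van (suc n) = VanishesBelow-⊛ van (VanishesBelow-^ van n)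

-- Products over the variables

infixl 7 _⋆_
_⋆_ : (ℕ → ℤ) → (ℕ → ℤ) → ℕ → ℤ
(φ ⋆ ψ) e = sumAntidiagonal e (λ b c → φ b * ψ c)

⋆-comm : ∀ φ ψ e → (φ ⋆ ψ) e ≡ (ψ ⋆ φ) e
⋆-comm φ ψ e = trans (sumAntidiagonal-comm e _) (sumAntidiagonal-cong e (λ b c → *-comm (φ c) (ψ b)))

infix 4 _≗₊_
_≗₊_ : (ℕ → ℤ) → (ℕ → ℤ) → Set
φ ≗₊ ψ = ∀ e → φ (suc e) ≡ ψ (suc e)

-- varProd φ is the product ∏_{i,j} φ(x_{i,j}) over all variables of the one-variable power
-- series φ with coefficients φ 0 = 1, φ 1, φ 2, …
varProd : (ℕ → ℤ) → Series
varProd φ = foldr (λ x acc → φ (exponent x) * acc) (+ 1)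

varProd-consNZ : ∀ φ → φ 0 ≡ + 1 → ∀ i j a μ → varProd φ (consNZ (i , j , a) μ) ≡ φ a * varProd φ μ
varProd-consNZ φ φ0≡1 i j zero    μ = sym (trans (cong (_* varProd φ μ) φ0≡1) (*-identityˡ _))
varProd-consNZ φ φ0≡1 i j (suc a) μ = refl

varProd-⋆ : ∀ φ ψ → φ 0 ≡ + 1 → ψ 0 ≡ + 1 → varProd φ ⊛ varProd ψ ≗ varProd (φ ⋆ ψ)
varProd-⋆ φ ψ φ0≡1 ψ0≡1 [] = refl
varProd-⋆ φ ψ φ0≡1 ψ0≡1 ((i , j , e) ∷ ν) = begin
  (varProd φ ⊛ varProd ψ) ((i , j , e) ∷ ν)
    ≡⟨ ⊛-cons (varProd φ) (varProd ψ) i j e ν ⟩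
  sumAntidiagonal e (λ b c → ((varProd φ ↾ (i , j , b)) ⊛ (varProd ψ ↾ (i , j , c))) ν)
    ≡⟨ sumAntidiagonal-cong e slice ⟩
  sumAntidiagonal e (λ b c → X * (φ b * ψ c))
    ≡⟨ sumAntidiagonal-*ˡ e X (λ b c → φ b * ψ c) ⟩
  X * (φ ⋆ ψ) e
    ≡⟨ *-comm X _ ⟩
  (φ ⋆ ψ) e * X
    ≡⟨ cong ((φ ⋆ ψ) e *_) (varProd-⋆ φ ψ φ0≡1 ψ0≡1 ν) ⟩
  varProd (φ ⋆ ψ) ((i , j , e) ∷ ν)
    ∎
  where
  open ≡-Reasoning
  X = (varProd φ ⊛ varProd ψ) ν
  slice : ∀ b c → ((varProd φ ↾ (i , j , b)) ⊛ (varProd ψ ↾ (i , j , c))) ν ≡ X * (φ b * ψ c)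
  slice b c = begin
    ((varProd φ ↾ (i , j , b)) ⊛ (varProd ψ ↾ (i , j , c))) ν
      ≡⟨ ⊛-congˡ (varProd ψ ↾ (i , j , c)) (varProd-consNZ φ φ0≡1 i j b) ν ⟩
    ((φ b · varProd φ) ⊛ (varProd ψ ↾ (i , j , c))) ν
      ≡⟨ ⊛-congʳ (φ b · varProd φ) (varProd-consNZ ψ ψ0≡1 i j c) ν ⟩
    ((φ b · varProd φ) ⊛ (ψ c · varProd ψ)) ν
      ≡⟨ ⊛-·ˡ (φ b) (varProd φ) (ψ c · varProd ψ) ν ⟩
    φ b * (varProd φ ⊛ (ψ c · varProd ψ)) ν
      ≡⟨ cong (φ b *_) (⊛-·ʳ (ψ c) (varProd φ) (varProd ψ) ν) ⟩
    φ b * (ψ c * X)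
      ≡⟨ rotate (φ b) (ψ c) X ⟩
    X * (φ b * ψ c)
      ∎
    where
    rotate : ∀ x y z → x * (y * z) ≡ z * (x * y)
    rotate = ℤ-Solver.solve-∀

varProd-cong : ∀ φ ψ → φ ≗₊ ψ → varProd φ ≈ varProd ψ
varProd-cong φ ψ φ≗ψ []                     _                 = refl
varProd-cong φ ψ φ≗ψ ((i , j , suc e) ∷ ν) ((_ , s≤s _) ∷ pν) = cong₂ _*_ (φ≗ψ e) (varProd-cong φ ψ φ≗ψ ν pν)

monomialSeq : ℕ → ℕ → ℤ
monomialSeq s b = if b ≡ᵇ s then + 1 else + 0

varProd-unit : varProd (monomialSeq 0) ≈ oneS
varProd-unit []                     _                 = refl
varProd-unit ((i , j , suc e) ∷ ν) ((_ , s≤s _) ∷ _) = refl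

shift : ℕ → (ℕ → ℤ) → ℕ → ℤ
shift zero    ψ e       = ψ e
shift (suc s) ψ zero    = + 0
shift (suc s) ψ (suc e) = shift s ψ e

shift-+ : ∀ s ψ d → shift s ψ (s ℕ.+ d) ≡ ψ d
shift-+ zero    ψ d = refl
shift-+ (suc s) ψ d = shift-+ s ψ d

shift-< : ∀ {s e} ψ → e < s → shift s ψ e ≡ + 0
shift-< {suc s} {zero}  ψ _         = refl
shift-< {suc s} {suc e} ψ (s≤s e<s) = shift-< ψ e<s

monomialSeq-⋆ : ∀ s ψ e → (monomialSeq s ⋆ ψ) e ≡ shift s ψ e
monomialSeq-⋆ zero    ψ zero    = *-identityˡ (ψ 0)
monomialSeq-⋆ (suc s) ψ zero    = refl
monomialSeq-⋆ zero    ψ (suc e) =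
  trans (cong₂ _+_ (*-identityˡ (ψ (suc e))) (sumAntidiagonal-zero e)) (+-identityʳ _)
monomialSeq-⋆ (suc s) ψ (suc e) = trans (+-identityˡ _) (monomialSeq-⋆ s ψ e)

data Cut (a : ℕ) : ℕ → Set where
  below  : ∀ {e} → e < a → Cut a e
  beyond : ∀ d → Cut a (a ℕ.+ d)

cut : ∀ a e → Cut a e
cut a e with e ℕ.<? a
... | yes e<a = below e<a
... | no  e≮a = subst (Cut a) (ℕₚ.m+[n∸m]≡n (ℕₚ.≮⇒≥ e≮a)) (beyond (e ∸ a))

-- Coefficients of 1 + c·tᵐ, 1 − tᵐ, 1 + tᵐ, φ(tᵐ), 1/(1 − tᵐ) and 1/(1 + tᵐ) for m = suc m′;
-- multiplicities are written suc m′ throughout so that powSub, _%_ and _/_ compute.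
onePlusMonomial : ℤ → ℕ → ℕ → ℤ
onePlusMonomial c m′ zero    = + 1
onePlusMonomial c m′ (suc e) = if suc e ≡ᵇ suc m′ then c else + 0

oneMinusPow : ℕ → ℕ → ℤ
oneMinusPow = onePlusMonomial -1ℤ

onePlusPow : ℕ → ℕ → ℤ
onePlusPow = onePlusMonomial (+ 1)

stretch : ℕ → (ℕ → ℤ) → ℕ → ℤ
stretch m′ φ e = if e % suc m′ ≡ᵇ 0 then φ (e / suc m′) else + 0

geometricPow : ℕ → ℕ → ℤ
geometricPow m′ = stretch m′ (λ _ → + 1)

altGeometricPow : ℕ → ℕ → ℤ
altGeometricPow m′ = stretch m′ sgnℤ

oneMinusPow-monomials : ∀ m′ b → oneMinusPow m′ b ≡ monomialSeq 0 b - monomialSeq (suc m′) b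
oneMinusPow-monomials m′ zero    = refl
oneMinusPow-monomials m′ (suc b) with b ≡ᵇ m′
... | true  = refl
... | false = refl

oneMinusPow-⋆-shift : ∀ m′ ψ e → (oneMinusPow m′ ⋆ ψ) e ≡ ψ e - shift (suc m′) ψ e
oneMinusPow-⋆-shift m′ ψ e = begin
  sumAntidiagonal e (λ b c → oneMinusPow m′ b * ψ c)
    ≡⟨ sumAntidiagonal-cong e (λ b c → trans (cong (_* ψ c) (oneMinusPow-monomials m′ b))
                                           (distrib (monomialSeq 0 b) (monomialSeq (suc m′) b) (ψ c))) ⟩
  sumAntidiagonal e (λ b c → monomialSeq 0 b * ψ c + -1ℤ * (monomialSeq (suc m′) b * ψ c))
    ≡⟨ sumAntidiagonal-+ e (λ b c → monomialSeq 0 b * ψ c) (λ b c → -1ℤ * (monomialSeq (suc m′) b * ψ c)) ⟩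
  (monomialSeq 0 ⋆ ψ) e + sumAntidiagonal e (λ b c → -1ℤ * (monomialSeq (suc m′) b * ψ c))
    ≡⟨ cong (_+_ ((monomialSeq 0 ⋆ ψ) e))
            (trans (sumAntidiagonal-*ˡ e -1ℤ (λ b c → monomialSeq (suc m′) b * ψ c)) (-1*i≡-i _)) ⟩
  (monomialSeq 0 ⋆ ψ) e - (monomialSeq (suc m′) ⋆ ψ) e
    ≡⟨ cong₂ _-_ (monomialSeq-⋆ 0 ψ e) (monomialSeq-⋆ (suc m′) ψ e) ⟩
  ψ e - shift (suc m′) ψ e
    ∎
  where
  open ≡-Reasoning
  distrib : ∀ x y z → (x - y) * z ≡ x * z + -1ℤ * (y * z)
  distrib = ℤ-Solver.solve-∀

oneMinusPow-⋆ : ∀ m′ {ψ χ : ℕ → ℤ} → (∀ {e} → e < suc m′ → ψ e ≡ χ e) →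
                (∀ d → ψ (suc m′ ℕ.+ d) ≡ χ (suc m′ ℕ.+ d) + ψ d) →
                ∀ e → (oneMinusPow m′ ⋆ ψ) e ≡ χ e
oneMinusPow-⋆ m′ {ψ} {χ} low step e = trans (oneMinusPow-⋆-shift m′ ψ e) (by-cut (cut (suc m′) e))
  where
  by-cut : ∀ {e} → Cut (suc m′) e → ψ e - shift (suc m′) ψ e ≡ χ e
  by-cut (below e<m) = trans (cong (_-_ (ψ _)) (shift-< ψ e<m)) (trans (+-identityʳ _) (low e<m))
  by-cut (beyond d)  = begin
    ψ (suc m′ ℕ.+ d) - shift (suc m′) ψ (suc m′ ℕ.+ d)
      ≡⟨ cong₂ _-_ (step d) (shift-+ (suc m′) ψ d) ⟩
    χ (suc m′ ℕ.+ d) + ψ d - ψ d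
      ≡⟨ cancel (χ (suc m′ ℕ.+ d)) (ψ d) ⟩
    χ (suc m′ ℕ.+ d)
      ∎
    where
    open ≡-Reasoning
    cancel : ∀ x y → x + y - y ≡ x
    cancel = ℤ-Solver.solve-∀

%-periodic : ∀ m′ d → (suc m′ ℕ.+ d) % suc m′ ≡ d % suc m′
%-periodic m′ d = trans (cong (_% suc m′) (ℕₚ.+-comm (suc m′) d)) ([m+n]%n≡m%n d (suc m′))

/-periodic : ∀ m′ d → (suc m′ ℕ.+ d) / suc m′ ≡ suc (d / suc m′)
/-periodic m′ d =
  trans (m/n≡1+[m∸n]/n (ℕₚ.m≤m+n (suc m′) d)) (cong (λ r → suc (r / suc m′)) (ℕₚ.m+n∸m≡n (suc m′) d))

twice : ∀ m′ d → suc m′ ℕ.+ (suc m′ ℕ.+ d) ≡ suc (suc (m′ ℕ.* 2)) ℕ.+ d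
twice = ℕ-Solver.solve-∀

double : ∀ m′ → suc (suc (m′ ℕ.* 2)) ≡ suc m′ ℕ.+ suc m′
double = ℕ-Solver.solve-∀

geometricPow-periodic : ∀ m′ d → geometricPow m′ (suc m′ ℕ.+ d) ≡ geometricPow m′ d
geometricPow-periodic m′ d = cong (λ r → if r ≡ᵇ 0 then + 1 else + 0) (%-periodic m′ d)

geometricPow-small : ∀ m′ {e} → suc e < suc m′ → geometricPow m′ (suc e) ≡ + 0
geometricPow-small m′ e<m = cong (λ r → if r ≡ᵇ 0 then + 1 else + 0) (m<n⇒m%n≡m e<m)

altGeometricPow-antiperiodic : ∀ m′ d → altGeometricPow m′ (suc m′ ℕ.+ d) ≡ - altGeometricPow m′ d
altGeometricPow-antiperiodic m′ d
  rewrite %-periodic m′ d | /-periodic m′ d with d % suc m′ ≡ᵇ 0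
... | true  = refl
... | false = refl

altGeometricPow-small : ∀ m′ {e} → suc e < suc m′ → altGeometricPow m′ (suc e) ≡ + 0
altGeometricPow-small m′ {e} e<m rewrite m<n⇒m%n≡m e<m = refl

oneMinusPow⋆geometricPow : ∀ m′ → oneMinusPow m′ ⋆ geometricPow m′ ≗₊ monomialSeq 0
oneMinusPow⋆geometricPow m′ e = oneMinusPow-⋆ m′ low step (suc e)
  where
  low : ∀ {e} → e < suc m′ → geometricPow m′ e ≡ monomialSeq 0 e
  low {zero}  _   = refl
  low {suc e} e<m = geometricPow-small m′ e<m
  step : ∀ d → geometricPow m′ (suc m′ ℕ.+ d) ≡ monomialSeq 0 (suc m′ ℕ.+ d) + geometricPow m′ d
  step d = trans (geometricPow-periodic m′ d) (sym (+-identityˡ _))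

geometricPow⋆oneMinusPow² : ∀ m′ → geometricPow m′ ⋆ oneMinusPow (suc (m′ ℕ.* 2)) ≗₊ onePlusPow m′
geometricPow⋆oneMinusPow² m′ e =
  trans (⋆-comm (geometricPow m′) (oneMinusPow m₂′) (suc e)) (oneMinusPow-⋆ m₂′ low step (suc e))
  where
  m₂′ = suc (m′ ℕ.* 2)
  low : ∀ {e} → e < suc m₂′ → geometricPow m′ e ≡ onePlusPow m′ e
  low {e} e<2m with cut (suc m′) e
  ... | below {zero}  _   = refl
  ... | below {suc e} e<m = trans (geometricPow-small m′ e<m)
                                  (sym (if-false (dec-false (e ≟ m′) (λ { refl → ℕₚ.<-irrefl refl e<m }))))
  ... | beyond d = trans (geometricPow-periodic m′ d) (at-d d d<m)
    where
    d<m : d < suc m′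
    d<m = ℕₚ.+-cancelˡ-< (suc m′) d (suc m′) (subst (suc m′ ℕ.+ d <_) (double m′) e<2m)
    at-d : ∀ d → d < suc m′ → geometricPow m′ d ≡ onePlusPow m′ (suc m′ ℕ.+ d)
    at-d zero     _   = sym (if-true (dec-true (m′ ℕ.+ 0 ≟ m′) (ℕₚ.+-identityʳ m′)))
    at-d (suc d′) d<m = trans (geometricPow-small m′ d<m)
                              (sym (if-false (dec-false (m′ ℕ.+ suc d′ ≟ m′) (λ eq → ℕₚ.m+1+n≢m m′ eq))))
  step : ∀ d → geometricPow m′ (suc m₂′ ℕ.+ d) ≡ onePlusPow m′ (suc m₂′ ℕ.+ d) + geometricPow m′ d
  step d = begin
    geometricPow m′ (suc m₂′ ℕ.+ d)
      ≡⟨ cong (geometricPow m′) (twice m′ d) ⟨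
    geometricPow m′ (suc m′ ℕ.+ (suc m′ ℕ.+ d))
      ≡⟨ trans (geometricPow-periodic m′ _) (geometricPow-periodic m′ d) ⟩
    geometricPow m′ d
      ≡⟨ +-identityˡ _ ⟨
    + 0 + geometricPow m′ d
      ≡⟨ cong (_+ geometricPow m′ d) (if-false (dec-false (m₂′ ℕ.+ d ≟ m′) m₂′+d≢m′)) ⟨
    onePlusPow m′ (suc m₂′ ℕ.+ d) + geometricPow m′ d
      ∎
    where
    open ≡-Reasoning
    m₂′+d≢m′ : m₂′ ℕ.+ d ≢ m′
    m₂′+d≢m′ eq = ℕₚ.<-irrefl (sym eq) (s≤s (ℕₚ.≤-trans (ℕₚ.m≤m*n m′ 2) (ℕₚ.m≤m+n _ d)))

oneMinusPow⋆geometricPow² : ∀ m′ → oneMinusPow m′ ⋆ geometricPow (suc (m′ ℕ.* 2)) ≗₊ altGeometricPow m′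
oneMinusPow⋆geometricPow² m′ e = oneMinusPow-⋆ m′ low (<-rec _ step) (suc e)
  where
  m₂′ = suc (m′ ℕ.* 2)
  m<2m : ∀ {e} → e < suc m′ → e < suc m₂′
  m<2m e<m = ℕₚ.≤-trans e<m (s≤s (ℕₚ.≤-trans (ℕₚ.m≤m*n m′ 2) (ℕₚ.n≤1+n _)))
  low : ∀ {e} → e < suc m′ → geometricPow m₂′ e ≡ altGeometricPow m′ e
  low {zero}  _   = refl
  low {suc e} e<m = trans (geometricPow-small m₂′ (m<2m e<m)) (sym (altGeometricPow-small m′ e<m))
  -- Induction in steps of m: geometricPow m₂′ has period 2m, altGeometricPow m′ changes sign
  -- after m.
  Step : ℕ → Set
  Step d = geometricPow m₂′ (suc m′ ℕ.+ d) ≡ altGeometricPow m′ (suc m′ ℕ.+ d) + geometricPow m₂′ d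
  step : ∀ d → (∀ {d′} → d′ < d → Step d′) → Step d
  step d rec with cut (suc m′) d
  ... | below d<m = begin
    geometricPow m₂′ (suc m′ ℕ.+ d)
      ≡⟨ geometricPow-small m₂′ m+d<2m ⟩
    + 0
      ≡⟨ +-inverseˡ (altGeometricPow m′ d) ⟨
    - altGeometricPow m′ d + altGeometricPow m′ d
      ≡⟨ cong₂ _+_ (altGeometricPow-antiperiodic m′ d) (low d<m) ⟨
    altGeometricPow m′ (suc m′ ℕ.+ d) + geometricPow m₂′ d
      ∎
    where
    open ≡-Reasoning
    m+d<2m : suc m′ ℕ.+ d < suc m₂′
    m+d<2m = subst (suc m′ ℕ.+ d <_) (sym (double m′)) (ℕₚ.+-monoʳ-< (suc m′) d<m)
  ... | beyond d′ = begin
    geometricPow m₂′ (suc m′ ℕ.+ (suc m′ ℕ.+ d′))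
      ≡⟨ cong (geometricPow m₂′) (twice m′ d′) ⟩
    geometricPow m₂′ (suc m₂′ ℕ.+ d′)
      ≡⟨ geometricPow-periodic m₂′ d′ ⟩
    geometricPow m₂′ d′
      ≡⟨ cancel (altGeometricPow m′ (suc m′ ℕ.+ d′)) (geometricPow m₂′ d′) ⟩
    - a + (a + geometricPow m₂′ d′)
      ≡⟨ cong₂ _+_ (altGeometricPow-antiperiodic m′ (suc m′ ℕ.+ d′)) (rec (ℕₚ.m<n+m d′ (s≤s z≤n))) ⟨
    altGeometricPow m′ (suc m′ ℕ.+ (suc m′ ℕ.+ d′)) + geometricPow m₂′ (suc m′ ℕ.+ d′)
      ∎
    where
    open ≡-Reasoning
    a = altGeometricPow m′ (suc m′ ℕ.+ d′)
    cancel : ∀ a b → b ≡ - a + (a + b)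
    cancel = ℤ-Solver.solve-∀

SupportedOnMultiples : ℕ → Series → Set
SupportedOnMultiples m F = ∀ μ → ¬ m ∣ weightMono μ → F μ ≡ + 0

varProd-supportedOnMultiples : ∀ m φ → (∀ e → ¬ m ∣ e → φ e ≡ + 0) → SupportedOnMultiples m (varProd φ)
varProd-supportedOnMultiples m φ φ-supp []                m∤0 = ⊥-elim (m∤0 (m ∣0))
varProd-supportedOnMultiples m φ φ-supp ((i , j , e) ∷ ν) m∤w with m ∣? e
... | no  m∤e = cong (_* varProd φ ν) (φ-supp e m∤e)
... | yes m∣e = trans (cong (φ e *_) (varProd-supportedOnMultiples m φ φ-supp ν m∤wν)) (*-zeroʳ (φ e))
  where m∤wν = λ m∣wν → m∤w (∣m∣n⇒∣m+n (∣n⇒∣m*n i m∣e) m∣wν)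

oneMinusPow-supported : ∀ m′ e → ¬ suc m′ ∣ e → oneMinusPow m′ e ≡ + 0
oneMinusPow-supported m′ zero    m∤0 = ⊥-elim (m∤0 (suc m′ ∣0))
oneMinusPow-supported m′ (suc e) m∤e = if-false (dec-false (e ≟ m′) (λ { refl → m∤e ∣-refl }))

geometricPow-supported : ∀ m′ e → ¬ suc m′ ∣ e → geometricPow m′ e ≡ + 0
geometricPow-supported m′ e m∤e = if-false (dec-false (e % suc m′ ≟ 0) (λ r≡0 → m∤e (m%n≡0⇒n∣m e (suc m′) r≡0)))

-- The substitution x ↦ xᵐ

totalExponent : Mono → ℕ
totalExponent = foldr (λ x n → exponent x ℕ.+ n) 0

foldr-insertS : ∀ {B : Set} (f : Stack → B → B) z → (∀ s t b → f s (f t b) ≡ f t (f s b)) →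
                ∀ s l → foldr f z (insertS s l) ≡ f s (foldr f z l)
foldr-insertS f z f-comm s []      = refl
foldr-insertS f z f-comm s (t ∷ l) with geᵇ s t
... | true  = refl
... | false = trans (cong (f t) (foldr-insertS f z f-comm s l)) (f-comm t s _)

foldr-sortS : ∀ {B : Set} (f : Stack → B → B) z → (∀ s t b → f s (f t b) ≡ f t (f s b)) →
              ∀ l → foldr f z (sortS l) ≡ foldr f z l
foldr-sortS f z f-comm []      = refl
foldr-sortS f z f-comm (s ∷ l) =
  trans (foldr-insertS f z f-comm s (sortS l)) (cong (f s) (foldr-sortS f z f-comm l))

foldr-monoType : ∀ {B : Set} (f : Stack → B → B) z → (∀ s t b → f s (f t b) ≡ f t (f s b)) →
                 ∀ μ → foldr f z (monoType μ) ≡ foldr (λ x → f (proj₁ x , exponent x)) z μ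
foldr-monoType f z f-comm μ =
  trans (foldr-sortS f z f-comm (map (λ x → proj₁ x , exponent x) μ)) (Listₚ.foldr-map f _ z μ)

weight-monoType : ∀ μ → weight (monoType μ) ≡ weightMono μ
weight-monoType = foldr-monoType _ 0 (λ s t _ → ℕ+.x∙yz≈y∙xz (proj₁ s ℕ.* proj₂ s) (proj₁ t ℕ.* proj₂ t) _)

area-monoType : ∀ μ → area (monoType μ) ≡ totalExponent μ
area-monoType = foldr-monoType _ 0 (λ s t _ → ℕ+.x∙yz≈y∙xz (proj₂ s) (proj₂ t) _)

length-monoType : ∀ μ → length (monoType μ) ≡ length μ
length-monoType = foldr-monoType _ 0 (λ _ _ _ → refl)

allOnes-monoType : ∀ μ → allOnes (monoType μ) ≡ allᵇ (λ x → exponent x ≡ᵇ 1) μ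
allOnes-monoType = foldr-monoType _ true (λ s t _ → x∙yz≈y∙xz (proj₂ s ≡ᵇ 1) (proj₂ t ≡ᵇ 1) _)
  where open CommutativeSemigroupProperties (CommutativeMonoid.commutativeSemigroup ∧-commutativeMonoid) using (x∙yz≈y∙xz)

sumM-component : ∀ k P c → sumM k P c ≗ component k (λ μ → if P (monoType μ) then c (monoType μ) else + 0)
sumM-component k P c μ =
  trans (cong (λ w → if (w ≡ᵇ k) ∧ P (monoType μ) then c (monoType μ) else + 0) (weight-monoType μ))
        (if-∧ (weightMono μ ≡ᵇ k))

signedIndicator-varProd : ∀ μ → Positive μ →
  (if allᵇ (λ x → exponent x ≡ᵇ 1) μ then sgnℤ (length μ) else + 0) ≡ varProd (oneMinusPow 0) μ
signedIndicator-varProd []                     _        = refl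
signedIndicator-varProd ((i , j , suc e) ∷ ν) (_ ∷ pν) rewrite sym (signedIndicator-varProd ν pν) with e
... | suc _ = refl
... | zero with allᵇ (λ x → exponent x ≡ᵇ 1) ν
...   | true  = sym (-1*i≡-i _)
...   | false = refl

indicator-varProd : ∀ μ → Positive μ →
  (if allᵇ (λ x → exponent x ≡ᵇ 1) μ then + 1 else + 0) ≡ varProd (onePlusPow 0) μ
indicator-varProd []                     _        = refl
indicator-varProd ((i , j , suc e) ∷ ν) (_ ∷ pν) rewrite sym (indicator-varProd ν pν) with e
... | suc _ = refl
... | zero with allᵇ (λ x → exponent x ≡ᵇ 1) ν
...   | true  = refl
...   | false = refl

sgn-+ : ∀ a b → sgnℤ (a ℕ.+ b) ≡ sgnℤ a * sgnℤ b
sgn-+ zero    b = sym (*-identityˡ (sgnℤ b))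
sgn-+ (suc a) b = trans (cong -_ (sgn-+ a b)) (neg-distribˡ-* (sgnℤ a) (sgnℤ b))

sgn-even : ∀ ℓ z → sgnℤ (ℓ ℕ.+ 2 ℕ.* z) ≡ sgnℤ ℓ
sgn-even ℓ z = trans (sgn-+ ℓ (2 ℕ.* z)) (trans (cong (sgnℤ ℓ *_) (even z)) (*-identityʳ (sgnℤ ℓ)))
  where
  even : ∀ z → sgnℤ (2 ℕ.* z) ≡ + 1
  even zero    = refl
  even (suc z) = trans (cong sgnℤ (double-suc z)) (trans (neg-involutive (sgnℤ (2 ℕ.* z))) (even z))
    where
    double-suc : ∀ z → 2 ℕ.* suc z ≡ suc (suc (2 ℕ.* z))
    double-suc = ℕ-Solver.solve-∀

sgn-varProd : ∀ μ → sgnℤ (totalExponent μ) ≡ varProd sgnℤ μ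
sgn-varProd []      = refl
sgn-varProd (x ∷ ν) = trans (sgn-+ (exponent x) _) (cong (sgnℤ (exponent x) *_) (sgn-varProd ν))

one-varProd : ∀ μ → + 1 ≡ varProd (λ _ → + 1) μ
one-varProd []      = refl
one-varProd (x ∷ ν) = trans (one-varProd ν) (sym (*-identityˡ _))

Ed≈component : ∀ k → Ed k ≈ component k (varProd (oneMinusPow 0))
Ed≈component k μ pμ = trans (sumM-component k allOnes (sgnℤ ∘ length) μ) (component-cong atType μ pμ)
  where
  atType : (λ ν → if allOnes (monoType ν) then sgnℤ (length (monoType ν)) else + 0) ≈[≤ k ] varProd (oneMinusPow 0)
  atType ν pν _ rewrite allOnes-monoType ν | length-monoType ν = signedIndicator-varProd ν pν

E⁺d≈component : ∀ k → E⁺d k ≈ component k (varProd (onePlusPow 0))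
E⁺d≈component k μ pμ = trans (sumM-component k allOnes (λ _ → + 1) μ) (component-cong atType μ pμ)
  where
  atType : (λ ν → if allOnes (monoType ν) then + 1 else + 0) ≈[≤ k ] varProd (onePlusPow 0)
  atType ν pν _ rewrite allOnes-monoType ν = indicator-varProd ν pν

Hd≈component : ∀ k → Hd k ≈ component k (varProd (λ _ → + 1))
Hd≈component k μ pμ =
  trans (sumM-component k (λ _ → true) (λ _ → + 1) μ) (component-cong (λ ν _ _ → one-varProd ν) μ pμ)

H⁺d≈component : ∀ k → H⁺d k ≈ component k (varProd sgnℤ)
H⁺d≈component k μ pμ =
  trans (sumM-component k (λ _ → true) (sgnℤ ∘ area) μ)
        (component-cong (λ ν _ _ → trans (cong sgnℤ (area-monoType ν)) (sgn-varProd ν)) μ pμ)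

-- powSub (suc m′) F μ unfolds to  if exponentsDivisible m′ μ then F (divideExponents m′ μ) else + 0.
exponentsDivisible : ℕ → Mono → Bool
exponentsDivisible m′ = allᵇ (λ x → exponent x % suc m′ ≡ᵇ 0)

divideExponents : ℕ → Mono → Mono
divideExponents m′ = map (λ x → proj₁ x , proj₁ (proj₂ x) , exponent x / suc m′)

exponentsDivisible-∷ : ∀ m′ x μ → exponentsDivisible m′ (x ∷ μ) ≡ true →
                       exponent x % suc m′ ≡ 0 × exponentsDivisible m′ μ ≡ true
exponentsDivisible-∷ m′ x μ div =
  ℕₚ.≡ᵇ⇒≡ _ 0 (subst T (sym (∧-conicalˡ _ _ div)) tt) , ∧-conicalʳ _ _ div

divisible⇒≡quotient* : ∀ m′ e → e % suc m′ ≡ 0 → e ≡ (e / suc m′) ℕ.* suc m′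
divisible⇒≡quotient* m′ e e%m≡0 = trans (m≡m%n+[m/n]*n e (suc m′)) (cong (ℕ._+ (e / suc m′) ℕ.* suc m′) e%m≡0)

weightMono-divideExponents : ∀ m′ μ → exponentsDivisible m′ μ ≡ true →
                             weightMono μ ≡ suc m′ ℕ.* weightMono (divideExponents m′ μ)
weightMono-divideExponents m′ []                _   = sym (ℕₚ.*-zeroʳ (suc m′))
weightMono-divideExponents m′ ((i , j , e) ∷ ν) div = begin
  i ℕ.* e ℕ.+ weightMono ν
    ≡⟨ cong₂ (λ a b → i ℕ.* a ℕ.+ b)
             (divisible⇒≡quotient* m′ e (proj₁ (exponentsDivisible-∷ m′ (i , j , e) ν div)))
             (weightMono-divideExponents m′ ν (proj₂ (exponentsDivisible-∷ m′ (i , j , e) ν div))) ⟩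
  i ℕ.* (e / suc m′ ℕ.* suc m′) ℕ.+ suc m′ ℕ.* weightMono (divideExponents m′ ν)
    ≡⟨ factor i (e / suc m′) (suc m′) _ ⟩
  suc m′ ℕ.* (i ℕ.* (e / suc m′) ℕ.+ weightMono (divideExponents m′ ν))
    ∎
  where
  open ≡-Reasoning
  factor : ∀ i q m w → i ℕ.* (q ℕ.* m) ℕ.+ m ℕ.* w ≡ m ℕ.* (i ℕ.* q ℕ.+ w)
  factor = ℕ-Solver.solve-∀

positive-divideExponents : ∀ m′ {μ} → Positive μ → exponentsDivisible m′ μ ≡ true →
                           Positive (divideExponents m′ μ)
positive-divideExponents m′ {[]}              []                  _   = []
positive-divideExponents m′ {(i , j , e) ∷ ν} ((1≤i , 1≤e) ∷ pν) div =
  (1≤i , ℕₚ.n≢0⇒n>0 e/m≢0) ∷ positive-divideExponents m′ pν (proj₂ (exponentsDivisible-∷ m′ (i , j , e) ν div))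
  where
  e/m≢0 : e / suc m′ ≢ 0
  e/m≢0 e/m≡0 =
    ℕₚ.<⇒≢ 1≤e (sym (trans (sym (m<n⇒m%n≡m (m/n≡0⇒m<n e/m≡0))) (proj₁ (exponentsDivisible-∷ m′ (i , j , e) ν div))))

powSub-cong : ∀ m′ {F G} → F ≈ G → powSub (suc m′) F ≈ powSub (suc m′) G
powSub-cong m′ {F} {G} F≈G μ pμ = guarded (exponentsDivisible m′ μ) refl
  where
  guarded : ∀ b → exponentsDivisible m′ μ ≡ b →
            (if b then F (divideExponents m′ μ) else + 0) ≡ (if b then G (divideExponents m′ μ) else + 0)
  guarded true  div = F≈G _ (positive-divideExponents m′ pμ div)
  guarded false _   = refl

powSub-component : ∀ m′ k G → powSub (suc m′) (component k G) ≗ component (suc m′ ℕ.* k) (powSub (suc m′) G)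
powSub-component m′ k G μ = guard-swap (exponentsDivisible m′ μ) same-weight
  where
  guard-swap : ∀ D {W W′} {x : ℤ} → (D ≡ true → W ≡ W′) →
               (if D then (if W′ then x else + 0) else + 0) ≡ (if W then (if D then x else + 0) else + 0)
  guard-swap false {W} _  = sym (if-eta W)
  guard-swap true       eq = cong (if_then _ else + 0) (sym (eq refl))
  same-weight : exponentsDivisible m′ μ ≡ true →
                (weightMono μ ≡ᵇ suc m′ ℕ.* k) ≡ (weightMono (divideExponents m′ μ) ≡ᵇ k)
  same-weight div rewrite weightMono-divideExponents m′ μ div with weightMono (divideExponents m′ μ) ≟ k
  ... | yes w≡k = trans (dec-true (_ ≟ _) (cong (suc m′ ℕ.*_) w≡k)) (sym (dec-true (_ ≟ k) w≡k))
  ... | no  w≢k = trans (dec-false (_ ≟ _) (w≢k ∘ ℕₚ.*-cancelˡ-≡ _ k (suc m′))) (sym (dec-false (_ ≟ k) w≢k))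

powSub-varProd : ∀ m′ φ → powSub (suc m′) (varProd φ) ≗ varProd (stretch m′ φ)
powSub-varProd m′ φ []      = refl
powSub-varProd m′ φ (x ∷ ν) =
  trans (guard-* (exponent x % suc m′ ≡ᵇ 0) (exponentsDivisible m′ ν))
        (cong (stretch m′ φ (exponent x) *_) (powSub-varProd m′ φ ν))
  where
  guard-* : ∀ a b {y z} → (if a ∧ b then y * z else + 0) ≡ (if a then y else + 0) * (if b then z else + 0)
  guard-* false b         = refl
  guard-* true  false {y} = sym (*-zeroʳ y)
  guard-* true  true      = refl

stretch-onePlusMonomial : ∀ c m′ e → stretch m′ (onePlusMonomial c 0) e ≡ onePlusMonomial c m′ e
stretch-onePlusMonomial c m′ e with cut (suc m′) e
... | below {zero}  _   = refl
... | below {suc e} e<m rewrite m<n⇒m%n≡m e<m =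
  sym (if-false (dec-false (e ≟ m′) (λ { refl → ℕₚ.<-irrefl refl e<m })))
... | beyond d rewrite %-periodic m′ d | /-periodic m′ d = at d
  where
  at : ∀ d → (if d % suc m′ ≡ᵇ 0 then (if d / suc m′ ≡ᵇ 0 then c else + 0) else + 0) ≡
             (if m′ ℕ.+ d ≡ᵇ m′ then c else + 0)
  at zero     = sym (if-true (dec-true (m′ ℕ.+ 0 ≟ m′) (ℕₚ.+-identityʳ m′)))
  at (suc d′) = trans vanish (sym (if-false (dec-false (m′ ℕ.+ suc d′ ≟ m′) (ℕₚ.m+1+n≢m m′))))
    where
    vanish : (if suc d′ % suc m′ ≡ᵇ 0 then (if suc d′ / suc m′ ≡ᵇ 0 then c else + 0) else + 0) ≡ + 0
    vanish with suc d′ % suc m′ ≟ 0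
    ... | no  r≢0 = if-false (dec-false (suc d′ % suc m′ ≟ 0) r≢0)
    ... | yes r≡0 = trans (if-true (dec-true (suc d′ % suc m′ ≟ 0) r≡0)) (if-false (dec-false (suc d′ / suc m′ ≟ 0) q≢0))
      where
      q≢0 : suc d′ / suc m′ ≢ 0
      q≢0 q≡0 = ℕₚ.1+n≢0 (trans (sym (m<n⇒m%n≡m (m/n≡0⇒m<n {suc d′} {suc m′} q≡0))) r≡0)

powSub-via-varProd : ∀ m′ k {F} φ ψ → F ≈ component k (varProd φ) → stretch m′ φ ≗₊ ψ →
                     powSub (suc m′) F ≈ component (suc m′ ℕ.* k) (varProd ψ)
powSub-via-varProd m′ k {F} φ ψ F≈ stretched = begin
  powSub (suc m′) F
    ≈⟨ powSub-cong m′ F≈ ⟩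
  powSub (suc m′) (component k (varProd φ))
    ≈⟨ (λ μ _ → powSub-component m′ k (varProd φ) μ) ⟩
  component (suc m′ ℕ.* k) (powSub (suc m′) (varProd φ))
    ≈⟨ component-cong (λ μ _ _ → powSub-varProd m′ φ μ) ⟩
  component (suc m′ ℕ.* k) (varProd (stretch m′ φ))
    ≈⟨ component-cong (≈⇒≈[≤] (varProd-cong (stretch m′ φ) ψ stretched)) ⟩
  component (suc m′ ℕ.* k) (varProd ψ)
    ∎
  where open ≈-Reasoning

powSub-Ed : ∀ m′ k → powSub (suc m′) (Ed k) ≈ component (suc m′ ℕ.* k) (varProd (oneMinusPow m′))
powSub-Ed m′ k =
  powSub-via-varProd m′ k (oneMinusPow 0) (oneMinusPow m′) (Ed≈component k) (stretch-onePlusMonomial -1ℤ m′ ∘ suc)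

powSub-E⁺d : ∀ m′ k → powSub (suc m′) (E⁺d k) ≈ component (suc m′ ℕ.* k) (varProd (onePlusPow m′))
powSub-E⁺d m′ k =
  powSub-via-varProd m′ k (onePlusPow 0) (onePlusPow m′) (E⁺d≈component k) (stretch-onePlusMonomial (+ 1) m′ ∘ suc)

powSub-Hd : ∀ m′ k → powSub (suc m′) (Hd k) ≈ component (suc m′ ℕ.* k) (varProd (geometricPow m′))
powSub-Hd m′ k = powSub-via-varProd m′ k (λ _ → + 1) (geometricPow m′) (Hd≈component k) (λ _ → refl)

powSub-H⁺d : ∀ m′ k → powSub (suc m′) (H⁺d k) ≈ component (suc m′ ℕ.* k) (varProd (altGeometricPow m′))
powSub-H⁺d m′ k = powSub-via-varProd m′ k sgnℤ (altGeometricPow m′) (H⁺d≈component k) (λ _ → refl)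

-- Inverting 1 + Y up to a given weight

partialSum : (ℕ → Series) → ℕ → Series
partialSum F zero    = zeroS
partialSum F (suc d) = F (suc d) ⊕ partialSum F d

partialSum-cong : ∀ {F G} d → (∀ k → F k ≈ G k) → partialSum F d ≈ partialSum G d
partialSum-cong zero    F≈G μ pμ = refl
partialSum-cong (suc d) F≈G μ pμ = cong₂ _+_ (F≈G (suc d) μ pμ) (partialSum-cong d F≈G μ pμ)

partialSum-zero : ∀ F μ d → (∀ k → k < d → F (suc k) μ ≡ + 0) → partialSum F d μ ≡ + 0
partialSum-zero F μ zero    _   = refl
partialSum-zero F μ (suc d) F≡0 =
  cong₂ _+_ (F≡0 d (ℕₚ.n<1+n d)) (partialSum-zero F μ d (λ k k<d → F≡0 k (ℕₚ.m<n⇒m<1+n k<d)))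

partialSum-single : ∀ F μ q d → 1 ≤ q → q ≤ d → (∀ k → k ≢ q → F k μ ≡ + 0) →
                    partialSum F d μ ≡ F q μ
partialSum-single F μ q (suc d) 1≤q q≤1+d F≡0 with suc d ≟ q
... | yes refl = trans (cong (_+_ (F (suc d) μ)) (partialSum-zero F μ d others)) (+-identityʳ _)
  where others = λ k k<d → F≡0 (suc k) (λ eq → ℕₚ.<-irrefl (ℕₚ.suc-injective eq) k<d)
... | no  1+d≢q = trans (cong₂ _+_ (F≡0 (suc d) 1+d≢q) (partialSum-single F μ q d 1≤q q≤d F≡0)) (+-identityˡ _)
  where q≤d = ℕₚ.≤-pred (ℕₚ.≤∧≢⇒< q≤1+d (1+d≢q ∘ sym))
partialSum-single F μ q zero 1≤q q≤0 _ = ⊥-elim (ℕₚ.<-irrefl refl (ℕₚ.≤-trans 1≤q q≤0))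

oneS-nonempty : ∀ μ → μ ≢ [] → oneS μ ≡ + 0
oneS-nonempty []      μ≢[] = ⊥-elim (μ≢[] refl)
oneS-nonempty (_ ∷ _) _    = refl

partialSum-components : ∀ m′ A d → A [] ≡ + 1 → SupportedOnMultiples (suc m′) A →
  oneS ⊕ partialSum (λ k → component (suc m′ ℕ.* k) A) d ≈[≤ suc m′ ℕ.* d ] A
partialSum-components m′ A d A[]≡1 supp μ pμ wμ≤md with suc m′ ∣? weightMono μ
... | no m∤w =
  trans (cong₂ _+_ (oneS-nonempty μ (λ { refl → m∤w (suc m′ ∣0) }))
                   (partialSum-zero (λ k → component (suc m′ ℕ.* k) A) μ d (λ k _ → component-zero A μ _ (supp μ m∤w))))
        (sym (supp μ m∤w))
... | yes (divides zero w≡0) with weight≡0⇒[] pμ w≡0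
...   | refl = trans (cong (_+_ (+ 1)) (partialSum-zero (λ k → component (suc m′ ℕ.* k) A) [] d (λ k _ → refl)))
                     (sym A[]≡1)
partialSum-components m′ A d A[]≡1 supp μ pμ wμ≤md | yes (divides (suc q) w≡q*m) =
  trans (cong₂ _+_ (oneS-nonempty μ (λ { refl → ℕₚ.0≢1+n w≡m*q })) picked) (+-identityˡ _)
  where
  w≡m*q : weightMono μ ≡ suc m′ ℕ.* suc q
  w≡m*q = trans w≡q*m (ℕₚ.*-comm (suc q) (suc m′))
  q≤d : suc q ≤ d
  q≤d = ℕₚ.*-cancelˡ-≤ (suc m′) (subst (_≤ suc m′ ℕ.* d) w≡m*q wμ≤md)
  picked : partialSum (λ k → component (suc m′ ℕ.* k) A) d μ ≡ A μ
  picked = trans (partialSum-single (λ k → component (suc m′ ℕ.* k) A) μ (suc q) d (s≤s z≤n) q≤d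
                   (λ k k≢q → if-false (dec-false (weightMono μ ≟ suc m′ ℕ.* k)
                                (λ eq → k≢q (ℕₚ.*-cancelˡ-≡ k (suc q) (suc m′) (trans (sym eq) w≡m*q))))))
                 (if-true (dec-true (weightMono μ ≟ suc m′ ℕ.* suc q) w≡m*q))

VanishesBelow-partialSum-components : ∀ m′ A d → VanishesBelow (suc m′) (partialSum (λ k → component (suc m′ ℕ.* k) A) d)
VanishesBelow-partialSum-components m′ A d μ pμ wμ<m =
  partialSum-zero (λ k → component (suc m′ ℕ.* k) A) μ d
    (λ k _ → if-false (dec-false (weightMono μ ≟ suc m′ ℕ.* suc k)
                        (λ eq → ℕₚ.<⇒≱ wμ<m (subst (suc m′ ≤_) (sym eq) (ℕₚ.m≤m*n (suc m′) (suc k))))))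

alternatingSum : Series → ℕ → Series
alternatingSum Y zero    = zeroS
alternatingSum Y (suc n) = alternatingSum Y n ⊕ (sgnℤ n · (Y ^ n))

alternatingSum-telescopes : ∀ Y n → alternatingSum Y n ⊛ (oneS ⊕ Y) ≈ oneS ⊕ (sgnℤ (suc n) · (Y ^ n))
alternatingSum-telescopes Y zero    μ pμ =
  trans (⊛-zeroˡ (oneS ⊕ Y) (λ _ → refl) μ) (sym (trans (cong (_+_ (oneS μ)) (-1*i≡-i (oneS μ))) (+-inverseʳ (oneS μ))))
alternatingSum-telescopes Y (suc n) μ pμ = begin
  ((W ⊕ (s · Yⁿ)) ⊛ (oneS ⊕ Y)) μ
    ≡⟨ ⊛-comm (W ⊕ (s · Yⁿ)) (oneS ⊕ Y) μ ⟩
  ((oneS ⊕ Y) ⊛ (W ⊕ (s · Yⁿ))) μ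
    ≡⟨ ⊛-distribˡ-⊕ (oneS ⊕ Y) W (s · Yⁿ) μ ⟩
  ((oneS ⊕ Y) ⊛ W) μ + ((oneS ⊕ Y) ⊛ (s · Yⁿ)) μ
    ≡⟨ cong₂ _+_ (trans (⊛-comm (oneS ⊕ Y) W μ) (alternatingSum-telescopes Y n μ pμ))
                 (⊛-·ʳ s (oneS ⊕ Y) Yⁿ μ) ⟩
  (oneS μ + (- s) * Yⁿ μ) + s * ((oneS ⊕ Y) ⊛ Yⁿ) μ
    ≡⟨ cong (λ z → (oneS μ + (- s) * Yⁿ μ) + s * z)
            (trans (⊛-comm (oneS ⊕ Y) Yⁿ μ) (⊛-distribˡ-⊕ Yⁿ oneS Y μ)) ⟩
  (oneS μ + (- s) * Yⁿ μ) + s * ((Yⁿ ⊛ oneS) μ + (Yⁿ ⊛ Y) μ)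
    ≡⟨ cong (λ z → (oneS μ + (- s) * Yⁿ μ) + s * z)
            (cong₂ _+_ (trans (⊛-comm Yⁿ oneS μ) (⊛-identityˡ Yⁿ μ pμ)) (⊛-comm Yⁿ Y μ)) ⟩
  (oneS μ + (- s) * Yⁿ μ) + s * (Yⁿ μ + (Y ^ suc n) μ)
    ≡⟨ telescope (oneS μ) s (Yⁿ μ) ((Y ^ suc n) μ) ⟩
  oneS μ + s * (Y ^ suc n) μ
    ≡⟨ cong (λ z → oneS μ + z * (Y ^ suc n) μ) (neg-involutive s) ⟨
  (oneS ⊕ (sgnℤ (suc (suc n)) · (Y ^ suc n))) μ
    ∎
  where
  open ≡-Reasoning
  W  = alternatingSum Y n
  Yⁿ = Y ^ n
  s  = sgnℤ n
  telescope : ∀ (o s a b : ℤ) → (o + (- s) * a) + s * (a + b) ≡ o + s * b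
  telescope = ℤ-Solver.solve-∀

alternatingSum-inverse : ∀ {w Y A B} n → oneS ⊕ Y ≈[≤ w ] A → A ⊛ B ≈ oneS → VanishesBelow (suc w) (Y ^ n) →
                         alternatingSum Y n ≈[≤ w ] B
alternatingSum-inverse {w} {Y} {A} {B} n 1+Y≈A AB≈1 Yⁿ-vanish = begin
  W                 ≈⟨ ≈⇒≈[≤] (R.sym (R.*-identityʳ W)) ⟩
  W ⊛ oneS          ≈⟨ ≈⇒≈[≤] (⊛-cong {W} R.refl (R.sym AB≈1)) ⟩
  W ⊛ (A ⊛ B)       ≈⟨ ≈⇒≈[≤] (R.sym (R.*-assoc W A B)) ⟩
  (W ⊛ A) ⊛ B       ≈⟨ ≈[≤]-⊛ {F = W ⊛ A} {oneS} {B} {B} WA≈1 ≈[≤]-refl ⟩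
  oneS ⊛ B          ≈⟨ ≈⇒≈[≤] (⊛-identityˡ B) ⟩
  B                 ∎
  where
  open ≈[≤]-Reasoning w
  W = alternatingSum Y n
  drop-Yⁿ : oneS ⊕ (sgnℤ (suc n) · (Y ^ n)) ≈[≤ w ] oneS
  drop-Yⁿ μ pμ wμ≤w =
    trans (cong (λ y → oneS μ + sgnℤ (suc n) * y) (Yⁿ-vanish μ pμ (s≤s wμ≤w)))
          (trans (cong (_+_ (oneS μ)) (*-zeroʳ (sgnℤ (suc n)))) (+-identityʳ _))
  WA≈1 : W ⊛ A ≈[≤ w ] oneS
  WA≈1 = begin
    W ⊛ A                            ≈⟨ ≈[≤]-⊛ {F = W} {W} {A} ≈[≤]-refl (≈[≤]-sym 1+Y≈A) ⟩
    W ⊛ (oneS ⊕ Y)                   ≈⟨ ≈⇒≈[≤] (alternatingSum-telescopes Y n) ⟩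
    oneS ⊕ (sgnℤ (suc n) · (Y ^ n))  ≈⟨ drop-Yⁿ ⟩
    oneS                             ∎

alternatingSum-⊛ : ∀ Y K n → alternatingSum Y n ⊛ K ≗ λ μ → sumBelow n (λ ℓ → sgnℤ ℓ * ((Y ^ ℓ) ⊛ K) μ)
alternatingSum-⊛ Y K zero    μ = ⊛-zeroˡ K (λ _ → refl) μ
alternatingSum-⊛ Y K (suc n) μ = begin
  ((alternatingSum Y n ⊕ (sgnℤ n · (Y ^ n))) ⊛ K) μ
    ≡⟨ ⊛-comm _ K μ ⟩
  (K ⊛ (alternatingSum Y n ⊕ (sgnℤ n · (Y ^ n)))) μ
    ≡⟨ ⊛-distribˡ-⊕ K (alternatingSum Y n) (sgnℤ n · (Y ^ n)) μ ⟩
  (K ⊛ alternatingSum Y n) μ + (K ⊛ (sgnℤ n · (Y ^ n))) μ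
    ≡⟨ cong₂ _+_ (trans (⊛-comm K _ μ) (alternatingSum-⊛ Y K n μ))
                 (trans (⊛-·ʳ (sgnℤ n) K (Y ^ n) μ) (cong (sgnℤ n *_) (⊛-comm K (Y ^ n) μ))) ⟩
  sumBelow n (λ ℓ → sgnℤ ℓ * ((Y ^ ℓ) ⊛ K) μ) + sgnℤ n * ((Y ^ n) ⊛ K) μ
    ≡⟨ sumBelow-last n (λ ℓ → sgnℤ ℓ * ((Y ^ ℓ) ⊛ K) μ) ⟨
  sumBelow (suc n) (λ ℓ → sgnℤ ℓ * ((Y ^ ℓ) ⊛ K) μ)
    ∎
  where open ≡-Reasoning

-- The multinomial coefficient κ

singles : SP → ℕ
singles τ = length (filter (λ s → proj₂ s ≟ 1) τ)

doubles : SP → ℕ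
doubles τ = length (filter (λ s → proj₂ s ≟ 2) τ)

MultiplicitiesOneOrTwo : SP → Set
MultiplicitiesOneOrTwo = All (λ s → proj₂ s ≡ 1 ⊎ proj₂ s ≡ 2)

occurrences : List ℕ → List ℕ
occurrences ds = map (λ i → countℕ i ds) (deduplicate _≟_ ds)

totalOccurrences : List ℕ → ℕ
totalOccurrences ds = foldr ℕ._+_ 0 (occurrences ds)

product-ones : ∀ (f : ℕ → ℕ) K → All (λ j → f j ≡ 1) K → foldr ℕ._*_ 1 (map f K) ≡ 1
product-ones f []      []           = refl
product-ones f (j ∷ K) (fj≡1 ∷ f≡1) = cong₂ ℕ._*_ fj≡1 (product-ones f K f≡1)

product-single : ∀ (f : ℕ → ℕ) j₀ K → Unique K →
                 (∀ {j} → j ∈ K → j ≢ j₀ → f j ≡ 1) → (j₀ ∉ K → f j₀ ≡ 1) →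
                 foldr ℕ._*_ 1 (map f K) ≡ f j₀
product-single f j₀ []      _             _      absent = sym (absent λ ())
product-single f j₀ (j ∷ K) (j∉K ∷ uniqK) others absent with j ≟ j₀
... | yes refl = trans (cong (f j ℕ.*_) (product-ones f K (All.tabulate rest-one))) (ℕₚ.*-identityʳ (f j))
  where
  rest-one : ∀ {j′} → j′ ∈ K → f j′ ≡ 1
  rest-one j′∈K = others (there j′∈K) (λ { refl → All.lookup j∉K j′∈K refl })
... | no  j≢j₀ =
  trans (cong₂ ℕ._*_ (others (here refl) j≢j₀) (product-single f j₀ K uniqK (others ∘ there) (absent ∘ extend)))
        (ℕₚ.*-identityˡ _)
  where
  extend : j₀ ∉ K → j₀ ∉ j ∷ K
  extend j₀∉K (here j₀≡j)  = j≢j₀ (sym j₀≡j)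
  extend j₀∉K (there j₀∈K) = j₀∉K j₀∈K

countsWith-absent : ∀ j τ → j ∉ map proj₂ τ → countsWith j τ ≡ []
countsWith-absent j τ j∉ = cong (occurrences ∘ map proj₁) (Listₚ.filter-none (λ s → proj₂ s ≟ j) (All.tabulate absent))
  where
  absent : ∀ {s} → s ∈ τ → proj₂ s ≢ j
  absent {s} s∈τ refl = j∉ (∈-map⁺ proj₂ s∈τ)

multinomial-doubles : ∀ τ → doubles τ ≤ 1 → multinomial (countsWith 2 τ) ≡ 1
multinomial-doubles τ ≤1 with filter (λ s → proj₂ s ≟ 2) τ
... | []    = refl
... | (k , _) ∷ [] rewrite Listₚ.filter-accept (_≟ k) {k} {[]} refl = refl
... | _ ∷ _ ∷ _ with ≤1
...   | s≤s ()

κ≡multinomial-singles : ∀ τ → MultiplicitiesOneOrTwo τ → doubles τ ≤ 1 → κ τ ≡ multinomial (occurrences (degsWith 1 τ))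
κ≡multinomial-singles τ oneOrTwo ≤1 =
  product-single (λ j → multinomial (countsWith j τ)) 1 (deduplicate _≟_ (map proj₂ τ)) (deduplicate-! (map proj₂ τ))
    others (λ 1∉ → cong multinomial (countsWith-absent 1 τ (1∉ ∘ ∈-deduplicate⁺ _≟_)))
  where
  others : ∀ {j} → j ∈ deduplicate _≟_ (map proj₂ τ) → j ≢ 1 → multinomial (countsWith j τ) ≡ 1
  others {j} j∈ j≢1 with ∈-map⁻ proj₂ (∈-deduplicate⁻ _≟_ (map proj₂ τ) j∈)
  ... | s , s∈τ , refl with All.lookup oneOrTwo s∈τ
  ...   | inj₁ j≡1 = ⊥-elim (j≢1 j≡1)
  ...   | inj₂ refl = multinomial-doubles τ ≤1

module _ (b : ℕ) (ds : List ℕ) (b∉ds : b ∉ ds) where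

  private
    deduplicate-replicate : ∀ c → filter (¬? ∘ (b ≟_)) (deduplicate _≟_ (replicate c b ++ ds)) ≡ deduplicate _≟_ ds
    deduplicate-replicate zero =
      Listₚ.filter-all (¬? ∘ (b ≟_))
        (All.tabulate (λ y∈ b≡y → b∉ds (subst (_∈ ds) (sym b≡y) (∈-deduplicate⁻ _≟_ ds y∈))))
    deduplicate-replicate (suc c) =
      trans (Listₚ.filter-reject (¬? ∘ (b ≟_)) {b} (λ b≢b → b≢b refl))
            (trans (Listₚ.filter-idem (¬? ∘ (b ≟_)) (deduplicate _≟_ (replicate c b ++ ds))) (deduplicate-replicate c))

    countℕ-replicate : ∀ n → countℕ b (replicate n b ++ ds) ≡ n
    countℕ-replicate n = begin
      length (filter (_≟ b) (replicate n b ++ ds))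
        ≡⟨ cong length (Listₚ.filter-++ (_≟ b) (replicate n b) ds) ⟩
      length (filter (_≟ b) (replicate n b) ++ filter (_≟ b) ds)
        ≡⟨ cong₂ (λ xs ys → length (xs ++ ys))
                 (Listₚ.filter-all (_≟ b) (Allₚ.replicate⁺ n refl))
                 (Listₚ.filter-none (_≟ b) (All.tabulate (λ y∈ds y≡b → b∉ds (subst (_∈ ds) y≡b y∈ds)))) ⟩
      length (replicate n b ++ [])
        ≡⟨ trans (Listₚ.length-++ (replicate n b)) (trans (ℕₚ.+-identityʳ _) (Listₚ.length-replicate n)) ⟩
      n
        ∎
      where open ≡-Reasoning

    countℕ-replicate-other : ∀ n {i} → i ∈ ds → countℕ i (replicate n b ++ ds) ≡ countℕ i ds
    countℕ-replicate-other n i∈ds =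
      cong length (trans (Listₚ.filter-++ (_≟ _) (replicate n b) ds)
                         (cong (_++ _) (Listₚ.filter-none (_≟ _) (Allₚ.replicate⁺ n b≢i))))
      where b≢i = λ b≡i → b∉ds (subst (_∈ ds) (sym b≡i) i∈ds)

    occurrences-replicate : ∀ c → occurrences (replicate (suc c) b ++ ds) ≡ suc c ∷ occurrences ds
    occurrences-replicate c =
      trans (cong (map (λ i → countℕ i (replicate (suc c) b ++ ds))) (cong (b ∷_) (deduplicate-replicate c)))
            (cong₂ _∷_ (countℕ-replicate (suc c))
                       (Listₚ.map-cong-local (All.tabulate (countℕ-replicate-other (suc c) ∘ ∈-deduplicate⁻ _≟_ ds))))

  multinomial-replicate : ∀ c → multinomial (occurrences (replicate c b ++ ds)) ≡
                                ((c ℕ.+ totalOccurrences ds) C c) ℕ.* multinomial (occurrences ds)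
  multinomial-replicate zero    = sym (ℕₚ.*-identityˡ _)
  multinomial-replicate (suc c) = cong multinomial (occurrences-replicate c)

  totalOccurrences-replicate : ∀ c → totalOccurrences (replicate c b ++ ds) ≡ c ℕ.+ totalOccurrences ds
  totalOccurrences-replicate zero    = refl
  totalOccurrences-replicate (suc c) = cong (foldr ℕ._+_ 0) (occurrences-replicate c)

area-oneTwo : ∀ {τ} → MultiplicitiesOneOrTwo τ → area τ ≡ singles τ ℕ.+ 2 ℕ.* doubles τ
area-oneTwo                 []                = refl
area-oneTwo {(k , .1) ∷ τ} (inj₁ refl ∷ ot) = cong suc (area-oneTwo ot)
area-oneTwo {(k , .2) ∷ τ} (inj₂ refl ∷ ot) = trans (cong (2 ℕ.+_) (area-oneTwo ot)) (shuffle (singles τ) (doubles τ))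
  where
  shuffle : ∀ a b → 2 ℕ.+ (a ℕ.+ 2 ℕ.* b) ≡ a ℕ.+ 2 ℕ.* suc b
  shuffle = ℕ-Solver.solve-∀

-- Enumerating the index set

singleStack doubleStack : ℕ → Stack
singleStack b = (suc b , 1)
doubleStack b = (suc b , 2)

-- oneTwo b ℓ z lists the sorted stack partitions with degrees in [1, b], ℓ stacks of
-- multiplicity 1 and z ≤ 1 of multiplicity 2.  Those with degrees in [1, b + 1] arise from
-- those with degrees in [1, b] by prepending c copies of (b + 1)¹, preceded by (b + 1)² if
-- that stack is present.
withSingles : ℕ → ℕ → (ℕ → List SP) → (SP → SP) → List SP
withSingles b ℓ G pre =
  concatMap (λ c → map (λ σ → pre (replicate c (singleStack b) ++ σ)) (G (ℓ ∸ c))) (upTo (suc ℓ))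

oneTwo : ℕ → ℕ → ℕ → List SP
oneTwo zero    zero    zero          = [] ∷ []
oneTwo zero    zero    (suc z)       = []
oneTwo zero    (suc ℓ) z             = []
oneTwo (suc b) ℓ       zero          = withSingles b ℓ (λ l → oneTwo b l 0) id
oneTwo (suc b) ℓ       (suc zero)    = withSingles b ℓ (λ l → oneTwo b l 1) id ++
                                       withSingles b ℓ (λ l → oneTwo b l 0) (doubleStack b ∷_)
oneTwo (suc b) ℓ       (suc (suc z)) = []

data WithSingles (b ℓ : ℕ) (G : ℕ → List SP) (pre : SP → SP) : SP → Set where
  prefixed : ∀ c σ → c ≤ ℓ → σ ∈ G (ℓ ∸ c) → WithSingles b ℓ G pre (pre (replicate c (singleStack b) ++ σ))

withSingles-∈⁻ : ∀ b ℓ G pre {τ} → τ ∈ withSingles b ℓ G pre → WithSingles b ℓ G pre τ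
withSingles-∈⁻ b ℓ G pre τ∈
  with find (∈-concatMap⁻ (λ c → map (λ σ → pre (replicate c (singleStack b) ++ σ)) (G (ℓ ∸ c)))
                          {xs = upTo (suc ℓ)} τ∈)
... | c , c∈ , τ∈c with ∈-map⁻ (λ σ → pre (replicate c (singleStack b) ++ σ)) τ∈c
...   | σ , σ∈ , refl = prefixed c σ (ℕₚ.≤-pred (∈-upTo⁻ c∈)) σ∈

withSingles-∈⁺ : ∀ b ℓ G pre c {σ} → c ≤ ℓ → σ ∈ G (ℓ ∸ c) →
                 pre (replicate c (singleStack b) ++ σ) ∈ withSingles b ℓ G pre
withSingles-∈⁺ b ℓ G pre c c≤ℓ σ∈ =
  ∈-concatMap⁺ (λ c → map (λ σ → pre (replicate c (singleStack b) ++ σ)) (G (ℓ ∸ c))) {xs = upTo (suc ℓ)}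
    (lose (∈-upTo⁺ (s≤s c≤ℓ)) (∈-map⁺ (λ σ → pre (replicate c (singleStack b) ++ σ)) σ∈))

singles-replicate : ∀ k c σ → singles (replicate c (k , 1) ++ σ) ≡ c ℕ.+ singles σ
singles-replicate k zero    σ = refl
singles-replicate k (suc c) σ = cong suc (singles-replicate k c σ)

doubles-replicate : ∀ k c σ → doubles (replicate c (k , 1) ++ σ) ≡ doubles σ
doubles-replicate k zero    σ = refl
doubles-replicate k (suc c) σ = doubles-replicate k c σ

degsWith-replicate : ∀ k c σ → degsWith 1 (replicate c (k , 1) ++ σ) ≡ replicate c k ++ degsWith 1 σ
degsWith-replicate k zero    σ = refl
degsWith-replicate k (suc c) σ = cong (k ∷_) (degsWith-replicate k c σ)

≥ₛ-refl : ∀ {s} → s ≥ₛ s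
≥ₛ-refl = inj₂ (refl , ℕₚ.≤-refl)

≥ₛ-trans : ∀ {s t u} → s ≥ₛ t → t ≥ₛ u → s ≥ₛ u
≥ₛ-trans (inj₁ t<s)         (inj₁ u<t)         = inj₁ (ℕₚ.<-trans u<t t<s)
≥ₛ-trans (inj₁ t<s)         (inj₂ (refl , _))  = inj₁ t<s
≥ₛ-trans (inj₂ (refl , _))  (inj₁ u<t)         = inj₁ u<t
≥ₛ-trans (inj₂ (refl , m≤)) (inj₂ (refl , n≤)) = inj₂ (refl , ℕₚ.≤-trans n≤ m≤)

≥ₛ-degree : ∀ {s t} → s ≥ₛ t → proj₁ t ≤ proj₁ s
≥ₛ-degree (inj₁ t<s)        = ℕₚ.<⇒≤ t<s
≥ₛ-degree (inj₂ (refl , _)) = ℕₚ.≤-refl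

sorted-below : ∀ {s τ} → Linked _≥ₛ_ (s ∷ τ) → All (s ≥ₛ_) τ
sorted-below {τ = []}    _       = []
sorted-below {τ = _ ∷ _} (r ∷ l) = Linked⇒All ≥ₛ-trans r l

sorted-∷ : ∀ {s τ} → All (s ≥ₛ_) τ → Linked _≥ₛ_ τ → Linked _≥ₛ_ (s ∷ τ)
sorted-∷ {τ = []}    _       _ = [-]
sorted-∷ {τ = _ ∷ _} (r ∷ _) l = r ∷ l

sorted-replicate : ∀ s c {σ} → All (s ≥ₛ_) σ → Linked _≥ₛ_ σ → Linked _≥ₛ_ (replicate c s ++ σ)
sorted-replicate s zero    s≥σ sorted = sorted
sorted-replicate s (suc c) s≥σ sorted =
  sorted-∷ (Allₚ.++⁺ (Allₚ.replicate⁺ c ≥ₛ-refl) s≥σ) (sorted-replicate s c s≥σ sorted)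

BoundedStack : ℕ → Stack → Set
BoundedStack b s = 1 ≤ proj₁ s × proj₁ s ≤ b × (proj₂ s ≡ 1 ⊎ proj₂ s ≡ 2)

record Shape (b ℓ z : ℕ) (τ : SP) : Set where
  field
    sorted       : Linked _≥ₛ_ τ
    bounded      : All (BoundedStack b) τ
    #singles     : singles τ ≡ ℓ
    #doubles     : doubles τ ≡ z
    #occurrences : totalOccurrences (degsWith 1 τ) ≡ ℓ

bounded-below : ∀ {b j σ} → All (BoundedStack b) σ → All ((suc b , j) ≥ₛ_) σ
bounded-below = All.map (λ (_ , k≤b , _) → inj₁ (s≤s k≤b))

bounded-suc : ∀ {b σ} → All (BoundedStack b) σ → All (BoundedStack (suc b)) σ
bounded-suc = All.map (λ (1≤k , k≤b , j) → 1≤k , ℕₚ.m≤n⇒m≤1+n k≤b , j)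

bounded-degsWith : ∀ {b σ} → All (BoundedStack b) σ → suc b ∉ degsWith 1 σ
bounded-degsWith {σ = σ} bounded b+1∈ with ∈-map⁻ proj₁ b+1∈
... | s , s∈ , refl with All.lookup bounded (proj₁ (∈-filter⁻ (λ s → proj₂ s ≟ 1) s∈))
...   | _ , b+1≤b , _ = ℕₚ.<-irrefl refl b+1≤b

shape-replicate : ∀ {b ℓ z} c {σ} → c ≤ ℓ → Shape b (ℓ ∸ c) z σ →
                  Shape (suc b) ℓ z (replicate c (singleStack b) ++ σ)
shape-replicate {b} {ℓ} c {σ} c≤ℓ shape = record
  { sorted       = sorted-replicate (singleStack b) c (bounded-below bounded) sorted
  ; bounded      = Allₚ.++⁺ (Allₚ.replicate⁺ c (s≤s z≤n , ℕₚ.≤-refl , inj₁ refl)) (bounded-suc bounded)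
  ; #singles     = trans (singles-replicate (suc b) c σ) (trans (cong (c ℕ.+_) #singles) (ℕₚ.m+[n∸m]≡n c≤ℓ))
  ; #doubles     = trans (doubles-replicate (suc b) c σ) #doubles
  ; #occurrences = begin
      totalOccurrences (degsWith 1 (replicate c (singleStack b) ++ σ))
        ≡⟨ cong totalOccurrences (degsWith-replicate (suc b) c σ) ⟩
      totalOccurrences (replicate c (suc b) ++ degsWith 1 σ)
        ≡⟨ totalOccurrences-replicate (suc b) (degsWith 1 σ) (bounded-degsWith bounded) c ⟩
      c ℕ.+ totalOccurrences (degsWith 1 σ)
        ≡⟨ cong (c ℕ.+_) #occurrences ⟩
      c ℕ.+ (ℓ ∸ c)
        ≡⟨ ℕₚ.m+[n∸m]≡n c≤ℓ ⟩
      ℓ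
        ∎
  }
  where
  open Shape shape
  open ≡-Reasoning

shape-double : ∀ {b ℓ τ} → Shape (suc b) ℓ 0 τ → All (doubleStack b ≥ₛ_) τ → Shape (suc b) ℓ 1 (doubleStack b ∷ τ)
shape-double shape d≥τ = record
  { sorted       = sorted-∷ d≥τ sorted
  ; bounded      = (s≤s z≤n , ℕₚ.≤-refl , inj₂ refl) ∷ bounded
  ; #singles     = #singles
  ; #doubles     = cong suc #doubles
  ; #occurrences = #occurrences
  }
  where open Shape shape

double-above : ∀ {b} c {σ} → All (BoundedStack b) σ → All (doubleStack b ≥ₛ_) (replicate c (singleStack b) ++ σ)
double-above c bounded = Allₚ.++⁺ (Allₚ.replicate⁺ c (inj₂ (refl , s≤s z≤n))) (bounded-below bounded)

oneTwo-shape : ∀ b ℓ z {τ} → τ ∈ oneTwo b ℓ z → Shape b ℓ z τ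
oneTwo-shape zero zero zero (here refl) = record
  { sorted = [] ; bounded = [] ; #singles = refl ; #doubles = refl ; #occurrences = refl }
oneTwo-shape (suc b) ℓ zero τ∈ with withSingles-∈⁻ b ℓ (λ l → oneTwo b l 0) id τ∈
... | prefixed c σ c≤ℓ σ∈ = shape-replicate c c≤ℓ (oneTwo-shape b (ℓ ∸ c) 0 σ∈)
oneTwo-shape (suc b) ℓ (suc zero) τ∈ with ∈-++⁻ (withSingles b ℓ (λ l → oneTwo b l 1) id) τ∈
... | inj₁ τ∈₁ with withSingles-∈⁻ b ℓ (λ l → oneTwo b l 1) id τ∈₁
...   | prefixed c σ c≤ℓ σ∈ = shape-replicate c c≤ℓ (oneTwo-shape b (ℓ ∸ c) 1 σ∈)
oneTwo-shape (suc b) ℓ (suc zero) τ∈ | inj₂ τ∈₂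
  with withSingles-∈⁻ b ℓ (λ l → oneTwo b l 0) (doubleStack b ∷_) τ∈₂
...   | prefixed c σ c≤ℓ σ∈ =
  shape-double (shape-replicate c c≤ℓ σ-shape) (double-above c (Shape.bounded σ-shape))
  where σ-shape = oneTwo-shape b (ℓ ∸ c) 0 σ∈

data Decomposition (b : ℕ) : SP → Set where
  singlesFirst : ∀ c {σ} → All (BoundedStack b) σ → Linked _≥ₛ_ σ →
                 Decomposition b (replicate c (singleStack b) ++ σ)
  doubleFirst  : ∀ c {σ} → All (BoundedStack b) σ → Linked _≥ₛ_ σ →
                 Decomposition b (doubleStack b ∷ replicate c (singleStack b) ++ σ)

decompose : ∀ b {τ} → Linked _≥ₛ_ τ → All (BoundedStack (suc b)) τ → doubles τ ≤ 1 → Decomposition b τ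
decompose b {[]} _ _ _ = singlesFirst 0 [] []
decompose b {(k , j) ∷ τ} sorted ((1≤k , k≤b+1 , j∈) ∷ bounded) ≤1 with k ℕ.≤? b
... | yes k≤b = singlesFirst 0 ((1≤k , k≤b , j∈) ∷ All.zipWith lower (sorted-below sorted , bounded)) sorted
  where
  lower : ∀ {s} → (k , j) ≥ₛ s × BoundedStack (suc b) s → BoundedStack b s
  lower (s≤ , 1≤k′ , _ , j′∈) = 1≤k′ , ℕₚ.≤-trans (≥ₛ-degree s≤) k≤b , j′∈
... | no k≰b with ℕₚ.≤-antisym k≤b+1 (ℕₚ.≰⇒> k≰b) | j∈
...   | refl | inj₁ refl with decompose b (Linked.tail sorted) bounded ≤1
...     | singlesFirst c bσ sσ = singlesFirst (suc c) bσ sσ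
...     | doubleFirst  c bσ sσ with sorted
...       | inj₁ b+1<b+1 ∷ _        = ⊥-elim (ℕₚ.<-irrefl refl b+1<b+1)
...       | inj₂ (_ , s≤s ()) ∷ _
decompose b {(k , j) ∷ τ} sorted ((1≤k , k≤b+1 , j∈) ∷ bounded) ≤1
  | no k≰b | refl | inj₂ refl with decompose b (Linked.tail sorted) bounded (ℕₚ.≤-trans (ℕₚ.n≤1+n _) ≤1)
...     | singlesFirst c bσ sσ = doubleFirst c bσ sσ
...     | doubleFirst  c bσ sσ with ≤1
...       | s≤s ()

∈-withSingles : ∀ b G pre c {σ} → σ ∈ G (singles σ) →
                pre (replicate c (singleStack b) ++ σ) ∈ withSingles b (c ℕ.+ singles σ) G pre
∈-withSingles b G pre c {σ} σ∈ =
  withSingles-∈⁺ b (c ℕ.+ singles σ) G pre c (ℕₚ.m≤m+n c (singles σ))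
    (subst (λ l → σ ∈ G l) (sym (ℕₚ.m+n∸m≡n c (singles σ))) σ∈)

prepend-singles : ∀ {b} c {σ} → doubles σ ≤ 1 → σ ∈ oneTwo b (singles σ) (doubles σ) →
                  replicate c (singleStack b) ++ σ ∈ oneTwo (suc b) (c ℕ.+ singles σ) (doubles σ)
prepend-singles {b} c {σ} ≤1 σ∈ with doubles σ | σ∈ | ≤1
... | zero        | σ∈′ | _ = ∈-withSingles b (λ l → oneTwo b l 0) id c σ∈′
... | suc zero    | σ∈′ | _ = ∈-++⁺ˡ (∈-withSingles b (λ l → oneTwo b l 1) id c σ∈′)
... | suc (suc _) | _   | s≤s ()

prepend-double : ∀ {b} c {σ} → σ ∈ oneTwo b (singles σ) 0 →
                 doubleStack b ∷ replicate c (singleStack b) ++ σ ∈ oneTwo (suc b) (c ℕ.+ singles σ) 1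
prepend-double {b} c {σ} σ∈ =
  ∈-++⁺ʳ (withSingles b (c ℕ.+ singles σ) (λ l → oneTwo b l 1) id)
         (∈-withSingles b (λ l → oneTwo b l 0) (doubleStack b ∷_) c σ∈)

oneTwo-complete : ∀ b {τ} → Linked _≥ₛ_ τ → All (BoundedStack b) τ → doubles τ ≤ 1 →
                  τ ∈ oneTwo b (singles τ) (doubles τ)
oneTwo-complete zero    {[]}    _      _                       _  = here refl
oneTwo-complete zero    {_ ∷ _} _      ((1≤k , k≤0 , _) ∷ _)   _  = ⊥-elim (ℕₚ.<-irrefl refl (ℕₚ.≤-trans 1≤k k≤0))
oneTwo-complete (suc b) sorted bounded ≤1 with decompose b sorted bounded ≤1
... | singlesFirst c {σ} bσ sσ =
  subst₂ (λ l z → replicate c (singleStack b) ++ σ ∈ oneTwo (suc b) l z)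
         (sym (singles-replicate (suc b) c σ)) (sym (doubles-replicate (suc b) c σ))
         (prepend-singles {b} c σ≤1 (oneTwo-complete b sσ bσ σ≤1))
  where σ≤1 = subst (_≤ 1) (doubles-replicate (suc b) c σ) ≤1
... | doubleFirst c {σ} bσ sσ =
  subst (λ l → doubleStack b ∷ replicate c (singleStack b) ++ σ ∈ oneTwo (suc b) l (suc (doubles (replicate c (singleStack b) ++ σ))))
        (sym (singles-replicate (suc b) c σ))
        (subst (λ z → doubleStack b ∷ replicate c (singleStack b) ++ σ ∈ oneTwo (suc b) (c ℕ.+ singles σ) (suc z)) (sym (trans (doubles-replicate (suc b) c σ) σ≡0))
               (prepend-double {b} c (subst (λ z → σ ∈ oneTwo b (singles σ) z) σ≡0
                                         (oneTwo-complete b sσ bσ (ℕₚ.≤-trans (ℕₚ.≤-reflexive σ≡0) z≤n)))))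
  where
  σ≡0 : doubles σ ≡ 0
  σ≡0 = ℕₚ.n≤0⇒n≡0 (ℕₚ.≤-pred (subst (λ z → suc z ≤ 1) (doubles-replicate (suc b) c σ) ≤1))

Unique-concatMap : ∀ {A B : Set} (key : B → A) (g : A → List B) {xs} → Unique xs →
                   (∀ x → Unique (g x)) → (∀ {x y} → y ∈ g x → key y ≡ x) → Unique (concatMap g xs)
Unique-concatMap key g {[]}     _             _      _    = []
Unique-concatMap key g {x ∷ xs} (x∉xs ∷ uniq) g-uniq keyed =
  Uniqueₚ.++⁺ (g-uniq x) (Unique-concatMap key g uniq g-uniq keyed) disjoint
  where
  disjoint : ∀ {y} → ¬ (y ∈ g x × y ∈ concatMap g xs)
  disjoint (y∈gx , y∈rest) with find (∈-concatMap⁻ g {xs = xs} y∈rest)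
  ... | x′ , x′∈xs , y∈gx′ = All.lookup x∉xs x′∈xs (trans (sym (keyed y∈gx)) (keyed y∈gx′))

singleCount : ℕ → SP → ℕ
singleCount b τ = length (filter (Productₚ.≡-dec _≟_ _≟_ (singleStack b)) τ)

singleCount-replicate : ∀ b c {σ} → All (BoundedStack b) σ → singleCount b (replicate c (singleStack b) ++ σ) ≡ c
singleCount-replicate b c {σ} bounded = begin
  length (filter P? (replicate c (singleStack b) ++ σ))
    ≡⟨ cong length (Listₚ.filter-++ P? (replicate c (singleStack b)) σ) ⟩
  length (filter P? (replicate c (singleStack b)) ++ filter P? σ)
    ≡⟨ cong₂ (λ xs ys → length (xs ++ ys))
             (Listₚ.filter-all P? (Allₚ.replicate⁺ c refl))
             (Listₚ.filter-none P? (All.map (λ { (_ , b+1≤b , _) refl → ℕₚ.<-irrefl refl b+1≤b }) bounded)) ⟩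
  length (replicate c (singleStack b) ++ [])
    ≡⟨ trans (Listₚ.length-++ (replicate c (singleStack b))) (trans (ℕₚ.+-identityʳ _) (Listₚ.length-replicate c)) ⟩
  c
    ∎
  where
  open ≡-Reasoning
  P? = Productₚ.≡-dec _≟_ _≟_ (singleStack b)

oneTwo-bounded : ∀ b ℓ z {σ} → σ ∈ oneTwo b ℓ z → All (BoundedStack b) σ
oneTwo-bounded b ℓ z σ∈ = Shape.bounded (oneTwo-shape b ℓ z σ∈)

Unique-withSingles : ∀ b ℓ z (pre : SP → SP) → (∀ l → Unique (oneTwo b l z)) →
  (∀ {τ τ′} → pre τ ≡ pre τ′ → τ ≡ τ′) → (∀ τ → singleCount b (pre τ) ≡ singleCount b τ) →
  Unique (withSingles b ℓ (λ l → oneTwo b l z) pre)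
Unique-withSingles b ℓ z pre uniq pre-injective pre-count =
  Unique-concatMap (singleCount b) (λ c → map (λ σ → pre (replicate c (singleStack b) ++ σ)) (oneTwo b (ℓ ∸ c) z))
    (Uniqueₚ.upTo⁺ (suc ℓ))
    (λ c → Uniqueₚ.map⁺ (λ eq → Listₚ.++-cancelˡ (replicate c (singleStack b)) _ _ (pre-injective eq)) (uniq (ℓ ∸ c)))
    keyed
  where
  keyed : ∀ {c τ} → τ ∈ map (λ σ → pre (replicate c (singleStack b) ++ σ)) (oneTwo b (ℓ ∸ c) z) → singleCount b τ ≡ c
  keyed {c} τ∈ with ∈-map⁻ (λ σ → pre (replicate c (singleStack b) ++ σ)) τ∈
  ... | σ , σ∈ , refl = trans (pre-count _) (singleCount-replicate b c (oneTwo-bounded b (ℓ ∸ c) z σ∈))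

withSingles-double : ∀ b ℓ G {τ} → τ ∈ withSingles b ℓ G (doubleStack b ∷_) → doubleStack b ∈ τ
withSingles-double b ℓ G τ∈ with withSingles-∈⁻ b ℓ G (doubleStack b ∷_) τ∈
... | prefixed _ _ _ _ = here refl

withSingles-no-double : ∀ b ℓ z {τ} → τ ∈ withSingles b ℓ (λ l → oneTwo b l z) id → All (_≢ doubleStack b) τ
withSingles-no-double b ℓ z τ∈ with withSingles-∈⁻ b ℓ (λ l → oneTwo b l z) id τ∈
... | prefixed c σ _ σ∈ =
  Allₚ.++⁺ (Allₚ.replicate⁺ c (λ ()))
           (All.map (λ { (_ , b+1≤b , _) refl → ℕₚ.<-irrefl refl b+1≤b }) (oneTwo-bounded b _ z σ∈))

oneTwo-unique : ∀ b ℓ z → Unique (oneTwo b ℓ z)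
oneTwo-unique zero    zero    zero          = [] ∷ []
oneTwo-unique zero    zero    (suc z)       = []
oneTwo-unique zero    (suc ℓ) z             = []
oneTwo-unique (suc b) ℓ       zero          = Unique-withSingles b ℓ 0 id (λ l → oneTwo-unique b l 0) id (λ _ → refl)
oneTwo-unique (suc b) ℓ       (suc zero)    =
  Uniqueₚ.++⁺ (Unique-withSingles b ℓ 1 id (λ l → oneTwo-unique b l 1) id (λ _ → refl))
              (Unique-withSingles b ℓ 0 (doubleStack b ∷_) (λ l → oneTwo-unique b l 0) Listₚ.∷-injectiveʳ
                                  (λ τ → cong length (Listₚ.filter-reject P? {doubleStack b} {τ} (λ ()))))
              disjoint
  where
  P? = Productₚ.≡-dec _≟_ _≟_ (singleStack b)
  disjoint : ∀ {τ} → ¬ (τ ∈ withSingles b ℓ (λ l → oneTwo b l 1) id ×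
                         τ ∈ withSingles b ℓ (λ l → oneTwo b l 0) (doubleStack b ∷_))
  disjoint (τ∈₁ , τ∈₂) =
    All.lookup (withSingles-no-double b ℓ 1 τ∈₁) (withSingles-double b ℓ (λ l → oneTwo b l 0) τ∈₂) refl
oneTwo-unique (suc b) ℓ       (suc (suc z)) = []

candidates : ℕ → List SP
candidates d = concatMap (λ ℓ → oneTwo d ℓ 0 ++ oneTwo d ℓ 1) (upTo (suc d))

indexList : ℕ → List SP
indexList d = filter (λ τ → weight τ ≟ d) (candidates d)

indexList-unique : ∀ d → Unique (indexList d)
indexList-unique d = Uniqueₚ.filter⁺ (λ τ → weight τ ≟ d)
  (Unique-concatMap singles (λ ℓ → oneTwo d ℓ 0 ++ oneTwo d ℓ 1) (Uniqueₚ.upTo⁺ (suc d))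
    (λ ℓ → Uniqueₚ.++⁺ (oneTwo-unique d ℓ 0) (oneTwo-unique d ℓ 1)
             (λ (τ∈₀ , τ∈₁) → ℕₚ.0≢1+n (trans (sym (Shape.#doubles (oneTwo-shape d ℓ 0 τ∈₀)))
                                               (Shape.#doubles (oneTwo-shape d ℓ 1 τ∈₁)))))
    (λ {ℓ} τ∈ → [ Shape.#singles ∘ oneTwo-shape d ℓ 0 , Shape.#singles ∘ oneTwo-shape d ℓ 1 ]′
                  (∈-++⁻ (oneTwo d ℓ 0) τ∈)))

PositiveStacks : SP → Set
PositiveStacks = All (λ s → 1 ≤ proj₁ s × 1 ≤ proj₂ s)

length≤weight : ∀ {τ} → PositiveStacks τ → length τ ≤ weight τ
length≤weight []                 = z≤n
length≤weight ((1≤k , 1≤j) ∷ ps) = ℕₚ.+-mono-≤ (ℕₚ.*-mono-≤ 1≤k 1≤j) (length≤weight ps)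

degree≤weight : ∀ {τ} → PositiveStacks τ → All (λ s → proj₁ s ≤ weight τ) τ
degree≤weight []                                 = []
degree≤weight {(k , suc j) ∷ τ} ((_ , _) ∷ ps) =
  ℕₚ.≤-trans (ℕₚ.m≤m*n k (suc j)) (ℕₚ.m≤m+n (k ℕ.* suc j) (weight τ)) ∷
  All.map (λ k′≤w → ℕₚ.≤-trans k′≤w (ℕₚ.m≤n+m (weight τ) (k ℕ.* suc j))) (degree≤weight ps)

∈-indexList : ∀ d {τ} → τ ∈ indexList d ⇔ (IsStackPartitionOf d τ × OneTwo τ)
∈-indexList d {τ} = mk⇔ to from
  where
  fromShape : ∀ {ℓ z} → z ≤ 1 → Shape d ℓ z τ → weight τ ≡ d → IsStackPartitionOf d τ × OneTwo τ
  fromShape z≤1 shape wτ≡d =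
    (All.map (λ { (1≤k , _ , inj₁ refl) → 1≤k , s≤s z≤n ; (1≤k , _ , inj₂ refl) → 1≤k , s≤s z≤n }) bounded ,
     sorted , wτ≡d) ,
    (All.map (proj₂ ∘ proj₂) bounded , subst (_≤ 1) (sym #doubles) z≤1)
    where open Shape shape
  to : τ ∈ indexList d → IsStackPartitionOf d τ × OneTwo τ
  to τ∈ with ∈-filter⁻ (λ τ → weight τ ≟ d) {xs = candidates d} τ∈
  ... | τ∈c , wτ≡d with find (∈-concatMap⁻ (λ ℓ → oneTwo d ℓ 0 ++ oneTwo d ℓ 1) {xs = upTo (suc d)} τ∈c)
  ...   | ℓ , _ , τ∈ℓ with ∈-++⁻ (oneTwo d ℓ 0) τ∈ℓ
  ...     | inj₁ τ∈₀ = fromShape z≤n (oneTwo-shape d ℓ 0 τ∈₀) wτ≡d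
  ...     | inj₂ τ∈₁ = fromShape ℕₚ.≤-refl (oneTwo-shape d ℓ 1 τ∈₁) wτ≡d
  from : IsStackPartitionOf d τ × OneTwo τ → τ ∈ indexList d
  from ((positive , sorted , wτ≡d) , (oneOrTwo , ≤1)) =
    ∈-filter⁺ (λ τ → weight τ ≟ d) {xs = candidates d}
      (∈-concatMap⁺ (λ ℓ → oneTwo d ℓ 0 ++ oneTwo d ℓ 1) {xs = upTo (suc d)}
        (lose (∈-upTo⁺ (s≤s singles≤d)) (by-doubles ≤1 (oneTwo-complete d sorted bounded ≤1))))
      wτ≡d
    where
    bounded : All (BoundedStack d) τ
    bounded = All.zipWith (λ ((1≤k , _) , (k≤d , j∈)) → 1≤k , k≤d , j∈)
                (positive , All.zipWith id (All.map (λ k≤w → subst (_ ≤_) wτ≡d k≤w) (degree≤weight positive) , oneOrTwo))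
    singles≤d : singles τ ≤ d
    singles≤d = subst (singles τ ≤_) wτ≡d
                  (ℕₚ.≤-trans (Listₚ.length-filter (λ s → proj₂ s ≟ 1) τ) (length≤weight positive))
    by-doubles : doubles τ ≤ 1 → τ ∈ oneTwo d (singles τ) (doubles τ) →
                 τ ∈ oneTwo d (singles τ) 0 ++ oneTwo d (singles τ) 1
    by-doubles ≤1 τ∈ with doubles τ | ≤1
    ... | zero     | _ = ∈-++⁺ˡ τ∈
    ... | suc zero | _ = ∈-++⁺ʳ (oneTwo d (singles τ) 0) τ∈
    ... | suc (suc _) | s≤s ()

-- Expanding the powers of Y

κ-replicate : ∀ {b ℓ z} c {σ} → c ≤ ℓ → z ≤ 1 → Shape b (ℓ ∸ c) z σ →
              κ (replicate c (singleStack b) ++ σ) ≡ (ℓ C c) ℕ.* κ σ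
κ-replicate {b} {ℓ} c {σ} c≤ℓ z≤1 shape = begin
  κ (replicate c (singleStack b) ++ σ)
    ≡⟨ κ≡multinomial-singles _ (All.map (proj₂ ∘ proj₂) (Shape.bounded shape′))
                               (subst (_≤ 1) (sym (Shape.#doubles shape′)) z≤1) ⟩
  multinomial (occurrences (degsWith 1 (replicate c (singleStack b) ++ σ)))
    ≡⟨ cong (multinomial ∘ occurrences) (degsWith-replicate (suc b) c σ) ⟩
  multinomial (occurrences (replicate c (suc b) ++ degsWith 1 σ))
    ≡⟨ multinomial-replicate (suc b) (degsWith 1 σ) (bounded-degsWith bounded) c ⟩
  ((c ℕ.+ totalOccurrences (degsWith 1 σ)) C c) ℕ.* multinomial (occurrences (degsWith 1 σ))
    ≡⟨ cong₂ ℕ._*_ (cong (_C c) (trans (cong (c ℕ.+_) #occurrences) (ℕₚ.m+[n∸m]≡n c≤ℓ)))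
                   (sym (κ≡multinomial-singles σ (All.map (proj₂ ∘ proj₂) bounded) (subst (_≤ 1) (sym #doubles) z≤1))) ⟩
  (ℓ C c) ℕ.* κ σ
    ∎
  where
  open ≡-Reasoning
  open Shape shape
  shape′ = shape-replicate c c≤ℓ shape

κ-double : ∀ b {τ} → MultiplicitiesOneOrTwo τ → doubles τ ≡ 0 → κ (doubleStack b ∷ τ) ≡ κ τ
κ-double b {τ} oneOrTwo no-doubles =
  trans (κ≡multinomial-singles (doubleStack b ∷ τ) (inj₂ refl ∷ oneOrTwo)
                               (subst (λ n → suc n ≤ 1) (sym no-doubles) ℕₚ.≤-refl))
        (sym (κ≡multinomial-singles τ oneOrTwo (subst (_≤ 1) (sym no-doubles) z≤n)))

module StackSums (m′ : ℕ) (F : ℕ → Series) where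

  P : SP → Series
  P τ = partF F (scaleSP (suc m′) τ)

  f g : ℕ → Series
  f k = stackF F (k , suc m′ ℕ.* 1)
  g k = stackF F (k , suc m′ ℕ.* 2)

  Y Z : ℕ → Series
  Y = partialSum f
  Z = partialSum g

  weightedSum : List SP → Series
  weightedSum L μ = sumℤ (map (λ τ → + κ τ * P τ μ) L)

  P-replicate : ∀ b c σ → P (replicate c (singleStack b) ++ σ) ≈ (f (suc b) ^ c) ⊛ P σ
  P-replicate b c σ μ pμ = begin
    prodS (map (stackF F) (scaleSP (suc m′) (replicate c (singleStack b) ++ σ))) μ
      ≡⟨ cong (λ Xs → prodS Xs μ) factors ⟩
    prodS (replicate c (f (suc b)) ++ map (stackF F) (scaleSP (suc m′) σ)) μ
      ≡⟨ prodS-++ (replicate c (f (suc b))) _ μ pμ ⟩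
    (prodS (replicate c (f (suc b))) ⊛ P σ) μ
      ≡⟨ cong (λ X → (X ⊛ P σ) μ) (prodS-replicate c (f (suc b))) ⟩
    ((f (suc b) ^ c) ⊛ P σ) μ
      ∎
    where
    open ≡-Reasoning
    factors : map (stackF F) (scaleSP (suc m′) (replicate c (singleStack b) ++ σ)) ≡
              replicate c (f (suc b)) ++ map (stackF F) (scaleSP (suc m′) σ)
    factors = begin
      map (stackF F) (map _ (replicate c (singleStack b) ++ σ))
        ≡⟨ cong (map (stackF F)) (trans (Listₚ.map-++ _ (replicate c (singleStack b)) σ)
                                        (cong (_++ scaleSP (suc m′) σ) (Listₚ.map-replicate _ c (singleStack b)))) ⟩
      map (stackF F) (replicate c (suc b , suc m′ ℕ.* 1) ++ scaleSP (suc m′) σ)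
        ≡⟨ trans (Listₚ.map-++ (stackF F) (replicate c _) (scaleSP (suc m′) σ))
                 (cong (_++ map (stackF F) (scaleSP (suc m′) σ)) (Listₚ.map-replicate (stackF F) c _)) ⟩
      replicate c (f (suc b)) ++ map (stackF F) (scaleSP (suc m′) σ)
        ∎

  module _ (b ℓ : ℕ) (G : ℕ → List SP) (pre : SP → SP) (E K : Series)
    (κ-pre : ∀ c {σ} → c ≤ ℓ → σ ∈ G (ℓ ∸ c) → κ (pre (replicate c (singleStack b) ++ σ)) ≡ (ℓ C c) ℕ.* κ σ)
    (P-pre : ∀ τ → P (pre τ) ≈ E ⊛ P τ)
    (G-sum : ∀ l → weightedSum (G l) ≈ K ⊛ (Y b ^ l))
    where

    private
      block : ℕ → List SP
      block c = map (λ σ → pre (replicate c (singleStack b) ++ σ)) (G (ℓ ∸ c))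

      binomialTerm : ℕ → Series
      binomialTerm c = (f (suc b) ^ c) ⊛ (Y b ^ (ℓ ∸ c))

    weightedSum-block : ∀ c → c ≤ ℓ → weightedSum (block c) ≈ λ μ → + (ℓ C c) * ((E ⊛ K) ⊛ binomialTerm c) μ
    weightedSum-block c c≤ℓ μ pμ = begin
      sumℤ (map term (block c))
        ≡⟨ sumℤ-map term (λ σ → pre (replicate c (singleStack b) ++ σ)) (G (ℓ ∸ c)) ⟩
      sumℤ (map (λ σ → term (pre (replicate c (singleStack b) ++ σ))) (G (ℓ ∸ c)))
        ≡⟨ sumℤ-cong (G (ℓ ∸ c)) (All.tabulate per-σ) ⟩
      sumℤ (map (λ σ → + (ℓ C c) * (+ κ σ * ((E ⊛ (f (suc b) ^ c)) ⊛ P σ) μ)) (G (ℓ ∸ c)))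
        ≡⟨ sumℤ-*ˡ (+ (ℓ C c)) (λ σ → + κ σ * ((E ⊛ (f (suc b) ^ c)) ⊛ P σ) μ) (G (ℓ ∸ c)) ⟩
      + (ℓ C c) * sumℤ (map (λ σ → + κ σ * ((E ⊛ (f (suc b) ^ c)) ⊛ P σ) μ) (G (ℓ ∸ c)))
        ≡⟨ cong (+ (ℓ C c) *_) (⊛-sumℤ (E ⊛ (f (suc b) ^ c)) (G (ℓ ∸ c)) (λ σ → + κ σ) P μ) ⟨
      + (ℓ C c) * ((E ⊛ (f (suc b) ^ c)) ⊛ weightedSum (G (ℓ ∸ c))) μ
        ≡⟨ cong (+ (ℓ C c) *_) (⊛-cong {E ⊛ (f (suc b) ^ c)} R.refl (G-sum (ℓ ∸ c)) μ pμ) ⟩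
      + (ℓ C c) * ((E ⊛ (f (suc b) ^ c)) ⊛ (K ⊛ (Y b ^ (ℓ ∸ c)))) μ
        ≡⟨ cong (+ (ℓ C c) *_) (interchange E (f (suc b) ^ c) K (Y b ^ (ℓ ∸ c)) μ pμ) ⟩
      + (ℓ C c) * ((E ⊛ K) ⊛ binomialTerm c) μ
        ∎
      where
      open ≡-Reasoning
      open CommutativeSemigroupProperties R.*-commutativeSemigroup using (interchange)
      term : SP → ℤ
      term τ = + κ τ * P τ μ
      per-σ : ∀ {σ} → σ ∈ G (ℓ ∸ c) →
              term (pre (replicate c (singleStack b) ++ σ)) ≡ + (ℓ C c) * (+ κ σ * ((E ⊛ (f (suc b) ^ c)) ⊛ P σ) μ)
      per-σ {σ} σ∈ = begin
        + κ (pre (replicate c (singleStack b) ++ σ)) * P (pre (replicate c (singleStack b) ++ σ)) μ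
          ≡⟨ cong₂ _*_ (trans (cong +_ (κ-pre c c≤ℓ σ∈)) (pos-* (ℓ C c) (κ σ)))
                       (R.trans (P-pre _) (R.trans (⊛-cong {E} R.refl (P-replicate b c σ)) (R.sym (R.*-assoc E _ (P σ)))) μ pμ) ⟩
        + (ℓ C c) * + κ σ * ((E ⊛ (f (suc b) ^ c)) ⊛ P σ) μ
          ≡⟨ *-assoc (+ (ℓ C c)) (+ κ σ) _ ⟩
        + (ℓ C c) * (+ κ σ * ((E ⊛ (f (suc b) ^ c)) ⊛ P σ) μ)
          ∎

    weightedSum-withSingles : weightedSum (withSingles b ℓ G pre) ≈ E ⊛ (K ⊛ (Y (suc b) ^ ℓ))
    weightedSum-withSingles μ pμ = begin
      weightedSum (withSingles b ℓ G pre) μ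
        ≡⟨ sumℤ-concatMap (λ τ → + κ τ * P τ μ) block (upTo (suc ℓ)) ⟩
      sumℤ (map (λ c → weightedSum (block c) μ) (upTo (suc ℓ)))
        ≡⟨ sumℤ-cong (upTo (suc ℓ)) (All.tabulate (λ c∈ → weightedSum-block _ (ℕₚ.≤-pred (∈-upTo⁻ c∈)) μ pμ)) ⟩
      sumℤ (map (λ c → + (ℓ C c) * ((E ⊛ K) ⊛ binomialTerm c) μ) (upTo (suc ℓ)))
        ≡⟨ sumℤ-upTo (λ c → + (ℓ C c) * ((E ⊛ K) ⊛ binomialTerm c) μ) (suc ℓ) ⟩
      sumBelow (suc ℓ) (λ c → + (ℓ C c) * ((E ⊛ K) ⊛ binomialTerm c) μ)
        ≡⟨ ⊛-sumBelow (E ⊛ K) (suc ℓ) (λ c → + (ℓ C c)) binomialTerm μ ⟨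
      ((E ⊛ K) ⊛ (λ ν → sumBelow (suc ℓ) (λ c → + (ℓ C c) * binomialTerm c ν))) μ
        ≡⟨ ⊛-cong {E ⊛ K} R.refl (R.sym (binomial (f (suc b)) (Y b) ℓ)) μ pμ ⟩
      ((E ⊛ K) ⊛ (Y (suc b) ^ ℓ)) μ
        ≡⟨ ⊛-assoc E K (Y (suc b) ^ ℓ) μ ⟩
      (E ⊛ (K ⊛ (Y (suc b) ^ ℓ))) μ
        ∎
      where open ≡-Reasoning

  weightedSum-singles : ∀ b ℓ → weightedSum (oneTwo b ℓ 0) ≈ Y b ^ ℓ
  weightedSum-singles zero    zero    μ pμ = trans (+-identityʳ _) (*-identityˡ (oneS μ))
  weightedSum-singles zero    (suc ℓ) μ pμ = sym (⊛-zeroˡ (Y 0 ^ ℓ) (λ _ → refl) μ)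
  weightedSum-singles (suc b) ℓ = begin
    weightedSum (withSingles b ℓ (λ l → oneTwo b l 0) id)
      ≈⟨ weightedSum-withSingles b ℓ (λ l → oneTwo b l 0) id oneS oneS
           (λ c c≤ℓ σ∈ → κ-replicate c c≤ℓ z≤n (oneTwo-shape b _ 0 σ∈))
           (λ τ → R.sym (R.*-identityˡ (P τ)))
           (λ l → R.trans (weightedSum-singles b l) (R.sym (R.*-identityˡ (Y b ^ l)))) ⟩
    oneS ⊛ (oneS ⊛ (Y (suc b) ^ ℓ))
      ≈⟨ R.trans (R.*-identityˡ _) (R.*-identityˡ (Y (suc b) ^ ℓ)) ⟩
    Y (suc b) ^ ℓ
      ∎
    where open ≈-Reasoning

  weightedSum-double : ∀ b ℓ → weightedSum (oneTwo b ℓ 1) ≈ Z b ⊛ (Y b ^ ℓ)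
  weightedSum-double zero    zero    μ pμ = sym (⊛-zeroˡ (Y 0 ^ 0) (λ _ → refl) μ)
  weightedSum-double zero    (suc ℓ) μ pμ = sym (⊛-zeroˡ (Y 0 ^ suc ℓ) (λ _ → refl) μ)
  weightedSum-double (suc b) ℓ = begin
    weightedSum (withDouble₁ ++ withDouble₀)
      ≈⟨ (λ μ _ → sumℤ-++ (λ τ → + κ τ * P τ μ) withDouble₁ withDouble₀) ⟩
    weightedSum withDouble₁ ⊕ weightedSum withDouble₀
      ≈⟨ R.+-cong (weightedSum-withSingles b ℓ (λ l → oneTwo b l 1) id oneS (Z b)
                     (λ c c≤ℓ σ∈ → κ-replicate c c≤ℓ ℕₚ.≤-refl (oneTwo-shape b _ 1 σ∈))
                     (λ τ → R.sym (R.*-identityˡ (P τ)))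
                     (weightedSum-double b))
                  (weightedSum-withSingles b ℓ (λ l → oneTwo b l 0) (doubleStack b ∷_) (g (suc b)) oneS
                     κ-double-block (λ τ μ _ → refl)
                     (λ l → R.trans (weightedSum-singles b l) (R.sym (R.*-identityˡ (Y b ^ l))))) ⟩
    (oneS ⊛ (Z b ⊛ W)) ⊕ (g (suc b) ⊛ (oneS ⊛ W))
      ≈⟨ R.+-cong (R.*-identityˡ (Z b ⊛ W)) (R.*-congˡ {g (suc b)} (R.*-identityˡ W)) ⟩
    (Z b ⊛ W) ⊕ (g (suc b) ⊛ W)
      ≈⟨ R.distribʳ W (Z b) (g (suc b)) ⟨
    (Z b ⊕ g (suc b)) ⊛ W
      ≈⟨ R.*-congʳ {W} (R.+-comm (Z b) (g (suc b))) ⟩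
    Z (suc b) ⊛ W
      ∎
    where
    open ≈-Reasoning
    W = Y (suc b) ^ ℓ
    withDouble₁ = withSingles b ℓ (λ l → oneTwo b l 1) id
    withDouble₀ = withSingles b ℓ (λ l → oneTwo b l 0) (doubleStack b ∷_)
    κ-double-block : ∀ c {σ} → c ≤ ℓ → σ ∈ oneTwo b (ℓ ∸ c) 0 →
                     κ (doubleStack b ∷ replicate c (singleStack b) ++ σ) ≡ (ℓ C c) ℕ.* κ σ
    κ-double-block c c≤ℓ σ∈ =
      trans (κ-double b (All.map (proj₂ ∘ proj₂) (Shape.bounded shape′)) (Shape.#doubles shape′))
            (κ-replicate c c≤ℓ z≤n σ-shape)
      where
      σ-shape = oneTwo-shape b _ 0 σ∈
      shape′  = shape-replicate c c≤ℓ σ-shape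

-- The inversion formula

rhsSum-eval : ∀ F m L μ → rhsSum F m L μ ≡ sumℤ (map (λ τ → (sgnℤ (area τ) * + κ τ) * partF F (scaleSP m τ) μ) L)
rhsSum-eval F m []      μ = refl
rhsSum-eval F m (τ ∷ L) μ = cong (_+_ ((sgnℤ (area τ) * + κ τ) * partF F (scaleSP m τ) μ)) (rhsSum-eval F m L μ)

module InversionFormula
  (F : ℕ → Series) (φ : ℕ → ℕ → ℤ)
  (powSub-F : ∀ n k → powSub (suc n) (F k) ≈ component (suc n ℕ.* k) (varProd (φ n)))
  (φ-constant : ∀ n → φ n 0 ≡ + 1)
  (φ-supported : ∀ n e → ¬ suc n ∣ e → φ n e ≡ + 0)
  (m′ : ℕ) (β τ₀ : ℕ → ℤ) (β-constant : β 0 ≡ + 1)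
  (φ⋆β : φ m′ ⋆ β ≗₊ monomialSeq 0)
  (β⋆φ² : β ⋆ φ (suc (m′ ℕ.* 2)) ≗₊ τ₀)
  where

  open StackSums m′ F

  private
    m : ℕ
    m = suc m′

    Φ₁ Ψ Φ₂ : Series
    Φ₁ = varProd (φ m′)
    Ψ  = varProd β
    Φ₂ = varProd (φ (suc (m′ ℕ.* 2)))

  f≈component : ∀ k → f k ≈ component (m ℕ.* k) Φ₁
  f≈component k = subst (λ n → powSub (suc n) (F k) ≈ component (m ℕ.* k) Φ₁) (sym (ℕₚ.*-identityʳ m′)) (powSub-F m′ k)

  g≈component : ∀ k → g k ≈ component (m ℕ.* 2 ℕ.* k) Φ₂
  g≈component = powSub-F (suc (m′ ℕ.* 2))

  stack-homogeneous : ∀ k {j} → j ≡ 1 ⊎ j ≡ 2 → Homogeneous (m ℕ.* j ℕ.* k) (stackF F (k , m ℕ.* j))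
  stack-homogeneous k (inj₁ refl) =
    subst (λ w → Homogeneous w (f k)) (cong (ℕ._* k) (sym (ℕₚ.*-identityʳ m)))
          (Homogeneous-cong (R.sym (f≈component k)) (Homogeneous-component (m ℕ.* k) Φ₁))
  stack-homogeneous k (inj₂ refl) = Homogeneous-cong (R.sym (g≈component k)) (Homogeneous-component (m ℕ.* 2 ℕ.* k) Φ₂)

  P-homogeneous : ∀ {τ} → MultiplicitiesOneOrTwo τ → Homogeneous (m ℕ.* weight τ) (P τ)
  P-homogeneous {[]}          []             = subst (λ w → Homogeneous w oneS) (sym (ℕₚ.*-zeroʳ m)) Homogeneous-oneS
  P-homogeneous {(k , j) ∷ τ} (j∈ ∷ oneOrTwo) =
    subst (λ w → Homogeneous w (P ((k , j) ∷ τ))) (factor m′ j k (weight τ))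
          (Homogeneous-⊛ (stack-homogeneous k j∈) (P-homogeneous oneOrTwo))
    where
    factor : ∀ m′ j k w → suc m′ ℕ.* j ℕ.* k ℕ.+ suc m′ ℕ.* w ≡ suc m′ ℕ.* (k ℕ.* j ℕ.+ w)
    factor = ℕ-Solver.solve-∀

  private
    coefficient : SP → ℤ
    coefficient τ = sgnℤ (area τ) * + κ τ

    filtered : ℕ → Mono → SP → ℤ
    filtered d μ τ = if weight τ ≡ᵇ d then coefficient τ * P τ μ else + 0

  truncated-inverse : ∀ d →
    component (m ℕ.* d) (alternatingSum (Y d) (suc d) ⊛ (oneS ⊕ Z d)) ≈ component (m ℕ.* d) (varProd τ₀)
  truncated-inverse d =
    component-cong (≈[≤]-trans (≈[≤]-⊛ {F = W} {Ψ} {oneS ⊕ Z d} {Φ₂} W≈Ψ 1+Z≈Φ₂) (≈⇒≈[≤] ΨΦ₂≈τ₀))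
    where
    W = alternatingSum (Y d) (suc d)
    1+Y≈Φ₁ : oneS ⊕ Y d ≈[≤ m ℕ.* d ] Φ₁
    1+Y≈Φ₁ = ≈[≤]-trans (≈⇒≈[≤] (R.+-cong {oneS} R.refl (partialSum-cong d f≈component)))
                       (partialSum-components m′ Φ₁ d refl (varProd-supportedOnMultiples m (φ m′) (φ-supported m′)))
    1+Z≈Φ₂ : oneS ⊕ Z d ≈[≤ m ℕ.* d ] Φ₂
    1+Z≈Φ₂ = ≈[≤]-weaken (ℕₚ.*-monoˡ-≤ d (ℕₚ.m≤m*n m 2))
              (≈[≤]-trans (≈⇒≈[≤] (R.+-cong {oneS} R.refl (partialSum-cong d g≈component)))
                          (partialSum-components (suc (m′ ℕ.* 2)) Φ₂ d refl
                             (varProd-supportedOnMultiples (m ℕ.* 2) (φ (suc (m′ ℕ.* 2))) (φ-supported (suc (m′ ℕ.* 2))))))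
    Φ₁Ψ≈1 : Φ₁ ⊛ Ψ ≈ oneS
    Φ₁Ψ≈1 = R.trans (λ μ _ → varProd-⋆ (φ m′) β (φ-constant m′) β-constant μ)
                   (R.trans (varProd-cong (φ m′ ⋆ β) (monomialSeq 0) φ⋆β) varProd-unit)
    ΨΦ₂≈τ₀ : Ψ ⊛ Φ₂ ≈ varProd τ₀
    ΨΦ₂≈τ₀ = R.trans (λ μ _ → varProd-⋆ β (φ (suc (m′ ℕ.* 2))) β-constant (φ-constant _) μ)
                    (varProd-cong (β ⋆ φ (suc (m′ ℕ.* 2))) τ₀ β⋆φ²)
    Yᵈ⁺¹-vanishes : VanishesBelow (suc (m ℕ.* d)) (Y d ^ suc d)
    Yᵈ⁺¹-vanishes μ pμ wμ≤md =
      VanishesBelow-^ (VanishesBelow-cong (R.sym (partialSum-cong d f≈component)) (VanishesBelow-partialSum-components m′ Φ₁ d))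
                      (suc d) μ pμ (ℕₚ.<-≤-trans wμ≤md md<m+dm)
      where md<m+dm = s≤s (ℕₚ.≤-trans (ℕₚ.≤-reflexive (ℕₚ.*-comm m d)) (ℕₚ.m≤n+m (d ℕ.* m) m′))
    W≈Ψ : W ≈[≤ m ℕ.* d ] Ψ
    W≈Ψ = alternatingSum-inverse (suc d) 1+Y≈Φ₁ Φ₁Ψ≈1 Yᵈ⁺¹-vanishes

  -- P τ is homogeneous of weight m · weight τ, so filtering by weight τ ≡ d amounts to taking
  -- the component of weight m · d.
  filtered-term : ∀ {d ℓ z τ} → z ≤ 1 → Shape d ℓ z τ → ∀ μ → Positive μ →
    filtered d μ τ ≡ sgnℤ ℓ * (+ κ τ * component (m ℕ.* d) (P τ) μ)
  filtered-term {d} {ℓ} {z} {τ} z≤1 shape μ pμ with weight τ ≟ d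
  ... | yes refl = begin
    (if weight τ ≡ᵇ weight τ then coefficient τ * P τ μ else + 0)
      ≡⟨ if-true (dec-true (weight τ ≟ weight τ) refl) ⟩
    coefficient τ * P τ μ
      ≡⟨ cong (λ s → s * + κ τ * P τ μ) sgn-area ⟩
    sgnℤ ℓ * + κ τ * P τ μ
      ≡⟨ *-assoc (sgnℤ ℓ) (+ κ τ) (P τ μ) ⟩
    sgnℤ ℓ * (+ κ τ * P τ μ)
      ≡⟨ cong (λ x → sgnℤ ℓ * (+ κ τ * x)) (component-homogeneous (P-homogeneous oneOrTwo) μ pμ) ⟨
    sgnℤ ℓ * (+ κ τ * component (m ℕ.* weight τ) (P τ) μ)
      ∎
    where
    open ≡-Reasoning
    open Shape shape
    oneOrTwo = All.map (proj₂ ∘ proj₂) bounded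
    sgn-area : sgnℤ (area τ) ≡ sgnℤ ℓ
    sgn-area = trans (cong sgnℤ (trans (area-oneTwo oneOrTwo) (cong₂ (λ a b → a ℕ.+ 2 ℕ.* b) #singles #doubles)))
                     (sgn-even ℓ z)
  ... | no wτ≢d = trans (if-false (dec-false (weight τ ≟ d) wτ≢d)) (sym (begin
    sgnℤ ℓ * (+ κ τ * component (m ℕ.* d) (P τ) μ)
      ≡⟨ cong (λ x → sgnℤ ℓ * (+ κ τ * x))
              (component-homogeneous-≢ (P-homogeneous (All.map (proj₂ ∘ proj₂) (Shape.bounded shape)))
                                        (wτ≢d ∘ ℕₚ.*-cancelˡ-≡ (weight τ) d m) μ pμ) ⟩
    sgnℤ ℓ * (+ κ τ * + 0)
      ≡⟨ trans (cong (sgnℤ ℓ *_) (*-zeroʳ (+ κ τ))) (*-zeroʳ (sgnℤ ℓ)) ⟩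
    + 0
      ∎))
    where open ≡-Reasoning

  filtered-sum : ∀ d ℓ z → z ≤ 1 → ∀ μ → Positive μ →
    sumℤ (map (filtered d μ) (oneTwo d ℓ z)) ≡
    sgnℤ ℓ * component (m ℕ.* d) (weightedSum (oneTwo d ℓ z)) μ
  filtered-sum d ℓ z z≤1 μ pμ = begin
    sumℤ (map (filtered d μ) (oneTwo d ℓ z))
      ≡⟨ sumℤ-cong (oneTwo d ℓ z) (All.tabulate (λ τ∈ → filtered-term z≤1 (oneTwo-shape d ℓ z τ∈) μ pμ)) ⟩
    sumℤ (map (λ τ → sgnℤ ℓ * (+ κ τ * component (m ℕ.* d) (P τ) μ)) (oneTwo d ℓ z))
      ≡⟨ sumℤ-*ˡ (sgnℤ ℓ) (λ τ → + κ τ * component (m ℕ.* d) (P τ) μ) (oneTwo d ℓ z) ⟩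
    sgnℤ ℓ * sumℤ (map (λ τ → + κ τ * component (m ℕ.* d) (P τ) μ) (oneTwo d ℓ z))
      ≡⟨ cong (sgnℤ ℓ *_) (component-sumℤ (m ℕ.* d) (oneTwo d ℓ z) (λ τ → + κ τ) P μ) ⟨
    sgnℤ ℓ * component (m ℕ.* d) (weightedSum (oneTwo d ℓ z)) μ
      ∎
    where open ≡-Reasoning

  filtered-sum-level : ∀ d ℓ μ → Positive μ →
    sumℤ (map (filtered d μ) (oneTwo d ℓ 0 ++ oneTwo d ℓ 1)) ≡
    sgnℤ ℓ * component (m ℕ.* d) ((Y d ^ ℓ) ⊛ (oneS ⊕ Z d)) μ
  filtered-sum-level d ℓ μ pμ = begin
    sumℤ (map (filtered d μ) (oneTwo d ℓ 0 ++ oneTwo d ℓ 1))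
      ≡⟨ sumℤ-++ (filtered d μ) (oneTwo d ℓ 0) (oneTwo d ℓ 1) ⟩
    sumℤ (map (filtered d μ) (oneTwo d ℓ 0)) +
    sumℤ (map (filtered d μ) (oneTwo d ℓ 1))
      ≡⟨ cong₂ _+_ (filtered-sum d ℓ 0 z≤n μ pμ) (filtered-sum d ℓ 1 ℕₚ.≤-refl μ pμ) ⟩
    sgnℤ ℓ * component (m ℕ.* d) S₀ μ + sgnℤ ℓ * component (m ℕ.* d) S₁ μ
      ≡⟨ *-distribˡ-+ (sgnℤ ℓ) _ _ ⟨
    sgnℤ ℓ * (component (m ℕ.* d) S₀ μ + component (m ℕ.* d) S₁ μ)
      ≡⟨ cong (sgnℤ ℓ *_) (component-⊕ (m ℕ.* d) S₀ S₁ μ) ⟨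
    sgnℤ ℓ * component (m ℕ.* d) (S₀ ⊕ S₁) μ
      ≡⟨ cong (sgnℤ ℓ *_) (component-cong (≈⇒≈[≤] both) μ pμ) ⟩
    sgnℤ ℓ * component (m ℕ.* d) ((Y d ^ ℓ) ⊛ (oneS ⊕ Z d)) μ
      ∎
    where
    open ≡-Reasoning
    S₀ = weightedSum (oneTwo d ℓ 0)
    S₁ = weightedSum (oneTwo d ℓ 1)
    both : S₀ ⊕ S₁ ≈ (Y d ^ ℓ) ⊛ (oneS ⊕ Z d)
    both = R.trans (R.+-cong (weightedSum-singles d ℓ) (R.trans (weightedSum-double d ℓ) (R.*-comm (Z d) (Y d ^ ℓ))))
                   (R.trans (R.+-cong {Y d ^ ℓ} (R.sym (R.*-identityʳ (Y d ^ ℓ))) R.refl) (R.sym (R.distribˡ (Y d ^ ℓ) oneS (Z d))))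

  indexList-sum : ∀ d → (λ μ → sumℤ (map (λ τ → coefficient τ * P τ μ) (indexList d))) ≈
                        component (m ℕ.* d) (alternatingSum (Y d) (suc d) ⊛ (oneS ⊕ Z d))
  indexList-sum d μ pμ = begin
    sumℤ (map (λ τ → coefficient τ * P τ μ) (indexList d))
      ≡⟨ sumℤ-filter (λ τ → weight τ ≟ d) (λ τ → coefficient τ * P τ μ) (candidates d) ⟩
    sumℤ (map (filtered d μ) (candidates d))
      ≡⟨ sumℤ-concatMap (filtered d μ) (λ ℓ → oneTwo d ℓ 0 ++ oneTwo d ℓ 1) (upTo (suc d)) ⟩
    sumℤ (map (λ ℓ → sumℤ (map (filtered d μ) (oneTwo d ℓ 0 ++ oneTwo d ℓ 1))) (upTo (suc d)))
      ≡⟨ sumℤ-cong′ (upTo (suc d)) (λ ℓ → filtered-sum-level d ℓ μ pμ) ⟩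
    sumℤ (map (λ ℓ → sgnℤ ℓ * component (m ℕ.* d) ((Y d ^ ℓ) ⊛ (oneS ⊕ Z d)) μ) (upTo (suc d)))
      ≡⟨ sumℤ-upTo (λ ℓ → sgnℤ ℓ * component (m ℕ.* d) ((Y d ^ ℓ) ⊛ (oneS ⊕ Z d)) μ) (suc d) ⟩
    sumBelow (suc d) (λ ℓ → sgnℤ ℓ * component (m ℕ.* d) ((Y d ^ ℓ) ⊛ (oneS ⊕ Z d)) μ)
      ≡⟨ component-sumBelow (m ℕ.* d) (suc d) sgnℤ (λ ℓ → (Y d ^ ℓ) ⊛ (oneS ⊕ Z d)) μ ⟨
    component (m ℕ.* d) (λ ν → sumBelow (suc d) (λ ℓ → sgnℤ ℓ * ((Y d ^ ℓ) ⊛ (oneS ⊕ Z d)) ν)) μ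
      ≡⟨ component-cong (λ ν _ _ → alternatingSum-⊛ (Y d) (oneS ⊕ Z d) (suc d) ν) μ pμ ⟨
    component (m ℕ.* d) (alternatingSum (Y d) (suc d) ⊛ (oneS ⊕ Z d)) μ
      ∎
    where open ≡-Reasoning

  component≈rhsSum : ∀ d (L : List SP) → Unique L → (∀ τ → τ ∈ L ⇔ (IsStackPartitionOf d τ × OneTwo τ)) →
                     component (m ℕ.* d) (varProd τ₀) ≈ rhsSum F m L
  component≈rhsSum d L unique members μ pμ = begin
    component (m ℕ.* d) (varProd τ₀) μ
      ≡⟨ truncated-inverse d μ pμ ⟨
    component (m ℕ.* d) (alternatingSum (Y d) (suc d) ⊛ (oneS ⊕ Z d)) μ
      ≡⟨ indexList-sum d μ pμ ⟨
    sumℤ (map (λ τ → coefficient τ * P τ μ) (indexList d))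
      ≡⟨ sumℤ-same-elements (λ τ → coefficient τ * P τ μ) (indexList-unique d) unique
           (λ {τ} → ⇔.trans (∈-indexList d) (⇔.sym (members τ))) ⟩
    sumℤ (map (λ τ → coefficient τ * P τ μ) L)
      ≡⟨ rhsSum-eval F m L μ ⟨
    rhsSum F m L μ
      ∎
    where open ≡-Reasoning

validMono⇒positive : ∀ {μ} → ValidMono μ → Positive μ
validMono⇒positive (bounds , _) = All.map (λ (1≤i , _ , 1≤e) → 1≤i , 1≤e) bounds

module E-inversion (m′ : ℕ) = InversionFormula
  Ed oneMinusPow powSub-Ed (λ _ → refl) oneMinusPow-supported
  m′ (geometricPow m′) (onePlusPow m′) refl (oneMinusPow⋆geometricPow m′) (geometricPow⋆oneMinusPow² m′)

module H-inversion (m′ : ℕ) = InversionFormula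
  Hd geometricPow powSub-Hd (λ _ → refl) geometricPow-supported
  m′ (oneMinusPow m′) (altGeometricPow m′) refl
  (λ e → trans (⋆-comm (geometricPow m′) (oneMinusPow m′) (suc e)) (oneMinusPow⋆geometricPow m′ e))
  (oneMinusPow⋆geometricPow² m′)

-- The identity holds for d = 0 as well.
mainTheorem4 : (d m : ℕ) → 1 ≤ d → 1 ≤ m →
    (L : List SP) → Unique L →
    (∀ τ → τ ∈ L ⇔ (IsStackPartitionOf d τ × OneTwo τ)) →
    (powSub m (E⁺d d) ≐ rhsSum Ed m L) × (powSub m (H⁺d d) ≐ rhsSum Hd m L)
mainTheorem4 d (suc m′) _ _ L unique members =
  (λ μ valid → E-case μ (validMono⇒positive valid)) , (λ μ valid → H-case μ (validMono⇒positive valid))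
  where
  E-case : powSub (suc m′) (E⁺d d) ≈ rhsSum Ed (suc m′) L
  E-case = R.trans (powSub-E⁺d m′ d) (E-inversion.component≈rhsSum m′ d L unique members)
  H-case : powSub (suc m′) (H⁺d d) ≈ rhsSum Hd (suc m′) L
  H-case = R.trans (powSub-H⁺d m′ d) (H-inversion.component≈rhsSum m′ d L unique members)
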